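{- For all $n\ge1$, \[a_{\{0101,0102,0112,0120\}}(n)=a_{\{0101,0102,0112,0121\}}(n)=a_{\{0101,0112,0120,0121\}}(n)=1+\binom{n+1}{3}.\]
   Context: An ascent in an integer sequence $s_1\cdots s_m$ is an index $j$ with $s_j<s_{j+1}$; $\mathrm{asc}(s)$ is the number of ascents. An ascent sequence is a sequence $x_1\cdots x_n$ of nonnegative integers with $x_1=0$ and $x_i\le 1+\mathrm{asc}(x_1\cdots x_{i-1})$ for $i\ge2$. For a sequence $w$, $\mathrm{red}(w)$ replaces the $i$-th smallest distinct letter of $w$ by $i-1$. A pattern (e.g. $0101$, meaning the sequence $(0,1,0,1)$) is a sequence equal to its reduction. A sequence $x$ contains pattern $p=p_1\cdots p_k$ if there are indices $i_1<\cdots<i_k$ with $\mathrm{red}(x_{i_1}\cdots x_{i_k})=p$; otherwise it avoids $p$. For a set of patterns $P$, $\mathcal A_n(P)$ is the set of ascent sequences of length $n$ avoiding every pattern in $P$, and $a_P(n)=|\mathcal A_n(P)|$. -}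

module Defs where

open import Data.Nat using (ℕ; zero; suc; _+_; _≤_; _<_; _<?_; _<ᵇ_)
open import Data.Bool using (if_then_else_)
open import Data.Nat.Properties using (_≟_)
open import Data.List using (List; []; _∷_; length; filter; deduplicate; map; take; lookup)
open import Data.List.Relation.Binary.Sublist.Propositional using (_⊆_)
open import Data.List.Relation.Unary.All using (All)
open import Data.List.Relation.Unary.Unique.Propositional using (Unique)
open import Data.List.Membership.Propositional using (_∈_)
open import Data.Fin using (Fin; toℕ)
open import Data.Product using (Σ; ∃; _×_)
open import Relation.Binary.PropositionalEquality using (_≡_)
open import Relation.Nullary using (¬_)
open import Function.Bundles using (_⇔_)

ascFrom : ℕ → List ℕ → ℕ
ascFrom x [] = 0
ascFrom x (y ∷ s) = (if x <ᵇ y then 1 else 0) + ascFrom y s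

asc : List ℕ → ℕ
asc [] = 0
asc (x ∷ s) = ascFrom x s

-- Ascent sequence: x₁ = 0 and x_i ≤ 1 + asc(x₁⋯x_{i-1}) for i ≥ 2
-- (0-based index i ≥ 1 here; prefix x₁⋯x_{i-1} is  take i x).
record IsAscentSeq (x : List ℕ) : Set where
  field
    first : ∀ (i : Fin (length x)) → toℕ i ≡ 0 → lookup x i ≡ 0
    bound : ∀ (i : Fin (length x)) → ¬ (toℕ i ≡ 0) → lookup x i ≤ suc (asc (take (toℕ i) x))

red : List ℕ → List ℕ
red w = map (λ a → length (deduplicate _≟_ (filter (_<? a) w))) w

Contains : List ℕ → List ℕ → Set
Contains x p = ∃ λ s → (s ⊆ x) × (red s ≡ p)

Avoids : List ℕ → List ℕ → Set
Avoids x p = ¬ Contains x p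

InA : List (List ℕ) → ℕ → List ℕ → Set
InA P n x = (length x ≡ n) × IsAscentSeq x × All (Avoids x) P

HasCount : List (List ℕ) → ℕ → ℕ → Set
HasCount P n m = Σ (List (List ℕ)) λ L → Unique L × (∀ x → (x ∈ L) ⇔ InA P n x) × (length L ≡ m)

p0101 p0102 p0112 p0120 p0121 : List ℕ
p0101 = 0 ∷ 1 ∷ 0 ∷ 1 ∷ []
p0102 = 0 ∷ 1 ∷ 0 ∷ 2 ∷ []
p0112 = 0 ∷ 1 ∷ 1 ∷ 2 ∷ []
p0120 = 0 ∷ 1 ∷ 2 ∷ 0 ∷ []
p0121 = 0 ∷ 1 ∷ 2 ∷ 1 ∷ []

{-# OPTIONS --safe #-}

-- An ascent sequence avoiding one of the three pattern sets is built from 0 by appending letters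
-- one at a time, and appending v to y creates an occurrence of a pattern p exactly when y contains
-- the first three letters of an occurrence of p ending in v.  For each of the three sets the avoiders
-- fall into a handful of shapes (0ᵃ 1 2 ⋯ k kᵇ 0ᶜ and the like), so they form a generating tree:
-- a node is an avoider together with its shape class and its number k of ascents, and its children
-- are its extensions by a fixed list of letters depending on the class, such as k + 1, k and 0.
-- Invariants of the classes show that these are exactly the admissible letters.  As the classes of
-- the children depend only on the class of the parent, the number of descendants at depth m of a
-- node obeys a recurrence solved by Pascal's rule, and for the root 0 it is 1 + (m + 2 choose 3).

module Submission where

open import Defs
open import Data.Nat using (ℕ; zero; suc; _+_; _∸_; _≤_; s≤s⁻¹; _<_; _<?_; _<ᵇ_; z≤n; s≤s; z<s; s<s)
open import Data.Nat.Properties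
open import Data.Nat.ListAction using (sum)
open import Data.Nat.Combinatorics using (_C_; nC1≡n; nCk+nC[k+1]≡[n+1]C[k+1])
open import Data.Nat.Tactic.RingSolver using (solve-∀)
open import Data.Nat.ListAction.Properties using (sum-++)
open import Data.Bool using (true; false; if_then_else_)
open import Data.Unit using (⊤; tt)
open import Data.Empty using (⊥-elim)
open import Data.Fin using (Fin; toℕ) renaming (zero to fzero; suc to fsuc)
open import Data.List using (List; []; _∷_; [_]; _++_; _∷ʳ_; length; map; filter; deduplicate; concatMap; take; lookup; initLast; _∷ʳ′_)
open import Data.List.Properties using (length-map; length-++; length-++-sucʳ; map-∘; map-cong; map-++; map-concatMap; ∷ʳ-injectiveˡ; ∷ʳ-injectiveʳ)
open import Data.List.Membership.Propositional using (_∈_; find; lose)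
open import Data.List.Membership.Propositional.Properties using (∈-∃++; ∈-++⁻; ∈-++⁺ˡ; ∈-++⁺ʳ; ∈-map⁺; ∈-map⁻; ∈-filter⁺; ∈-filter⁻; ∈-deduplicate⁺; ∈-deduplicate⁻; ∈-concatMap⁺; ∈-concatMap⁻)
open import Data.List.Relation.Unary.Any using (here; there)
open import Data.List.Relation.Unary.All as All using (All; []; _∷_)
import Data.List.Relation.Unary.All.Properties as All
open import Data.List.Relation.Unary.AllPairs as AllPairs using ([]; _∷_)
import Data.List.Relation.Unary.AllPairs.Properties as AllPairs
open import Data.List.Relation.Unary.Unique.Propositional using (Unique)
import Data.List.Relation.Unary.Unique.Propositional.Properties as Unique
open import Data.List.Relation.Unary.Unique.DecPropositional.Properties _≟_ using (deduplicate-!)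
open import Data.List.Relation.Binary.Disjoint.Propositional using (Disjoint)
open import Data.List.Relation.Binary.Sublist.Propositional using (_⊆_; []; _∷_; ⊆-refl; ⊆-trans; to∈; from∈; minimum) renaming (_∷ʳ_ to skip)
open import Data.List.Relation.Binary.Sublist.Propositional.Properties using (++⁺; ++⁺ʳ; ∷ˡ⁻; length-mono-≤)
open import Data.Product using (∃; ∃₂; _×_; _,_; proj₁; proj₂)
open import Data.Sum as Sum using (_⊎_; inj₁; inj₂)
open import Function using (_∘_; case_of_)
open import Function.Bundles using (mk⇔)
open import Relation.Binary.Core using (_Preserves_⟶_)
open import Relation.Binary.Definitions using (tri<; tri≈; tri>)
open import Relation.Binary.PropositionalEquality using (_≡_; _≢_; refl; sym; trans; cong; cong₂; subst; subst₂; module ≡-Reasoning)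
open import Relation.Nullary using (¬_; yes; no; ¬?)
open import Relation.Unary using (Decidable; ∅)

open ≡-Reasoning

-- Reduction

module _ {A : Set} where

  unique⇒length≤ : {xs ys : List A} → Unique xs → (∀ {z} → z ∈ xs → z ∈ ys) → length xs ≤ length ys
  unique⇒length≤ {[]} _ _ = z≤n
  unique⇒length≤ {x ∷ xs} (x∉xs ∷ xs!) xs⊆ys with ∈-∃++ (xs⊆ys (here refl))
  ... | us , vs , refl = subst (suc (length xs) ≤_) (sym (length-++-sucʳ us x vs))
          (s≤s (unique⇒length≤ xs! λ z∈xs → ∈-remove (xs⊆ys (there z∈xs)) (All.lookup x∉xs z∈xs ∘ sym)))
    where
    ∈-remove : ∀ {z} → z ∈ us ++ x ∷ vs → z ≢ x → z ∈ us ++ vs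
    ∈-remove z∈ z≢x with ∈-++⁻ us z∈
    ... | inj₁ z∈us         = ∈-++⁺ˡ z∈us
    ... | inj₂ (here z≡x)   = ⊥-elim (z≢x z≡x)
    ... | inj₂ (there z∈vs) = ∈-++⁺ʳ us z∈vs

  filter-map : ∀ {B : Set} {P : A → Set} {Q : B → Set} {f : B → A} (P? : Decidable P) (Q? : Decidable Q) →
               (∀ {x} → P (f x) → Q x) → (∀ {x} → Q x → P (f x)) →
               ∀ xs → filter P? (map f xs) ≡ map f (filter Q? xs)
  filter-map P? Q? to from [] = refl
  filter-map {f = f} P? Q? to from (x ∷ xs) with P? (f x) | Q? x
  ... | yes _  | yes _ = cong (f x ∷_) (filter-map P? Q? to from xs)
  ... | no _   | no _  = filter-map P? Q? to from xs
  ... | yes p  | no ¬q = ⊥-elim (¬q (to p))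
  ... | no ¬p  | yes q = ⊥-elim (¬p (from q))

deduplicate-map : ∀ {f : ℕ → ℕ} → (∀ {x y} → f x ≡ f y → x ≡ y) →
                  ∀ xs → deduplicate _≟_ (map f xs) ≡ map f (deduplicate _≟_ xs)
deduplicate-map inj [] = refl
deduplicate-map {f} inj (x ∷ xs) = cong (f x ∷_) (begin
  filter (¬? ∘ (f x ≟_)) (deduplicate _≟_ (map f xs))  ≡⟨ cong (filter _) (deduplicate-map inj xs) ⟩
  filter (¬? ∘ (f x ≟_)) (map f (deduplicate _≟_ xs))  ≡⟨ filter-map (¬? ∘ (f x ≟_)) (¬? ∘ (x ≟_))
                                                            (λ fx≢fy x≡y → fx≢fy (cong f x≡y)) (λ x≢y fx≡fy → x≢y (inj fx≡fy))
                                                            (deduplicate _≟_ xs) ⟩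
  map f (filter (¬? ∘ (x ≟_)) (deduplicate _≟_ xs))    ∎)

below : ℕ → List ℕ → List ℕ
below a s = deduplicate _≟_ (filter (_<? a) s)

-- red w is, definitionally, map (λ a → rank a w) w.
rank : ℕ → List ℕ → ℕ
rank a s = length (below a s)

module _ {s : List ℕ} where

  ∈-below⁻ : ∀ {a z} → z ∈ below a s → z ∈ s × z < a
  ∈-below⁻ z∈ = ∈-filter⁻ (_<? _) (∈-deduplicate⁻ _≟_ (filter (_<? _) s) z∈)

  ∈-below⁺ : ∀ {a z} → z ∈ s → z < a → z ∈ below a s
  ∈-below⁺ z∈s z<a = ∈-deduplicate⁺ _≟_ (∈-filter⁺ (_<? _) z∈s z<a)

  rank-mono-≤ : ∀ {a b} → a ≤ b → rank a s ≤ rank b s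
  rank-mono-≤ a≤b = unique⇒length≤ (deduplicate-! _) λ z∈ →
    let z∈s , z<a = ∈-below⁻ z∈ in ∈-below⁺ z∈s (<-≤-trans z<a a≤b)

  rank-mono-< : ∀ {a b} → a ∈ s → a < b → rank a s < rank b s
  rank-mono-< {a} a∈s a<b = unique⇒length≤ (All.tabulate a≢ ∷ deduplicate-! _) λ where
      (here refl) → ∈-below⁺ a∈s a<b
      (there z∈)  → let z∈s , z<a = ∈-below⁻ z∈ in ∈-below⁺ z∈s (<-trans z<a a<b)
    where
    a≢ : ∀ {z} → z ∈ below a s → a ≢ z
    a≢ z∈ refl = <-irrefl refl (proj₂ (∈-below⁻ z∈))

  rank-cancel-< : ∀ {a b} → rank a s < rank b s → a < b
  rank-cancel-< r< = ≰⇒> λ b≤a → <⇒≱ r< (rank-mono-≤ b≤a)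

  rank-injective : ∀ {a b} → a ∈ s → b ∈ s → rank a s ≡ rank b s → a ≡ b
  rank-injective {a} {b} a∈s b∈s eq with <-cmp a b
  ... | tri< a<b _ _ = ⊥-elim (<-irrefl eq (rank-mono-< a∈s a<b))
  ... | tri≈ _ a≡b _ = a≡b
  ... | tri> _ _ b<a = ⊥-elim (<-irrefl (sym eq) (rank-mono-< b∈s b<a))

module _ {f : ℕ → ℕ} (f-mono : f Preserves _<_ ⟶ _<_) where

  private
    f-mono-≤ : ∀ {x y} → x ≤ y → f x ≤ f y
    f-mono-≤ x≤y with m≤n⇒m<n∨m≡n x≤y
    ... | inj₁ x<y  = <⇒≤ (f-mono x<y)
    ... | inj₂ refl = ≤-refl

    f-cancel-< : ∀ {x y} → f x < f y → x < y
    f-cancel-< fx<fy = ≰⇒> λ y≤x → <⇒≱ fx<fy (f-mono-≤ y≤x)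

    f-injective : ∀ {x y} → f x ≡ f y → x ≡ y
    f-injective fx≡fy = ≤-antisym (≮⇒≥ λ y<x → <-irrefl (sym fx≡fy) (f-mono y<x))
                                   (≮⇒≥ λ x<y → <-irrefl fx≡fy (f-mono x<y))

  rank-map : ∀ a s → rank (f a) (map f s) ≡ rank a s
  rank-map a s = begin
    length (deduplicate _≟_ (filter (_<? f a) (map f s)))
      ≡⟨ cong (length ∘ deduplicate _≟_) (filter-map (_<? f a) (_<? a) f-cancel-< f-mono s) ⟩
    length (deduplicate _≟_ (map f (filter (_<? a) s)))    ≡⟨ cong length (deduplicate-map f-injective (filter (_<? a) s)) ⟩
    length (map f (below a s))                             ≡⟨ length-map f (below a s) ⟩
    rank a s                                               ∎

  red-map : ∀ s → red (map f s) ≡ red s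
  red-map s = begin
    map (λ a → rank a (map f s)) (map f s)  ≡⟨ map-∘ s ⟨
    map (λ a → rank (f a) (map f s)) s      ≡⟨ map-cong (λ a → rank-map a s) s ⟩
    map (λ a → rank a s) s                  ∎

stretch : ℕ → ℕ → ℕ → ℕ → ℕ
stretch a b c 0             = a
stretch a b c 1             = b
stretch a b c (suc (suc n)) = n + c

stretch-mono : ∀ {a b c} → a < b → b < c → stretch a b c Preserves _<_ ⟶ _<_
stretch-mono a<b b<c {0}           {1}           _                 = a<b
stretch-mono a<b b<c {0}           {suc (suc n)} _                 = <-≤-trans (<-trans a<b b<c) (m≤n+m _ n)
stretch-mono a<b b<c {1}           {suc (suc n)} _                 = <-≤-trans b<c (m≤n+m _ n)
stretch-mono a<b b<c {suc (suc m)} {suc (suc n)} (s<s (s<s m<n))   = +-monoˡ-< _ m<n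
stretch-mono a<b b<c {1}           {1}           (s<s ())
stretch-mono a<b b<c {suc (suc m)} {1}           (s<s ())

module _ {a b c d : ℕ} where

  private
    w : List ℕ
    w = a ∷ b ∷ c ∷ d ∷ []

    ranks : ∀ {i j k l} → red w ≡ i ∷ j ∷ k ∷ l ∷ [] →
            rank a w ≡ i × rank b w ≡ j × rank c w ≡ k × rank d w ≡ l
    ranks refl = refl , refl , refl , refl

    rank-≡ : ∀ {x y i} → x ∈ w → y ∈ w → rank x w ≡ i → rank y w ≡ i → x ≡ y
    rank-≡ x∈ y∈ rx ry = rank-injective x∈ y∈ (trans rx (sym ry))

    rank-< : ∀ {x y i j} → rank x w ≡ i → rank y w ≡ j → i < j → x < y
    rank-< {x} {y} rx ry i<j = rank-cancel-< {w} {x} {y} (subst₂ _<_ (sym rx) (sym ry) i<j)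

    ∈₁ : a ∈ w
    ∈₁ = here refl
    ∈₂ : b ∈ w
    ∈₂ = there (here refl)
    ∈₃ : c ∈ w
    ∈₃ = there (there (here refl))
    ∈₄ : d ∈ w
    ∈₄ = there (there (there (here refl)))

  red-0101⁻ : red w ≡ p0101 → c ≡ a × d ≡ b × a < b
  red-0101⁻ eq = let ra , rb , rc , rd = ranks eq in
    rank-≡ ∈₃ ∈₁ rc ra , rank-≡ ∈₄ ∈₂ rd rb , rank-< ra rb z<s

  red-0102⁻ : red w ≡ p0102 → c ≡ a × a < b × b < d
  red-0102⁻ eq = let ra , rb , rc , rd = ranks eq in
    rank-≡ ∈₃ ∈₁ rc ra , rank-< ra rb z<s , rank-< rb rd (s<s z<s)

  red-0112⁻ : red w ≡ p0112 → c ≡ b × a < b × b < d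
  red-0112⁻ eq = let ra , rb , rc , rd = ranks eq in
    rank-≡ ∈₃ ∈₂ rc rb , rank-< ra rb z<s , rank-< rb rd (s<s z<s)

  red-0120⁻ : red w ≡ p0120 → d ≡ a × a < b × b < c
  red-0120⁻ eq = let ra , rb , rc , rd = ranks eq in
    rank-≡ ∈₄ ∈₁ rd ra , rank-< ra rb z<s , rank-< rb rc (s<s z<s)

  red-0121⁻ : red w ≡ p0121 → d ≡ b × a < b × b < c
  red-0121⁻ eq = let ra , rb , rc , rd = ranks eq in
    rank-≡ ∈₄ ∈₂ rd rb , rank-< ra rb z<s , rank-< rb rc (s<s z<s)

length-∷ʳ : ∀ {A : Set} (xs : List A) {x} → length (xs ∷ʳ x) ≡ suc (length xs)
length-∷ʳ xs = trans (length-++ xs) (+-comm (length xs) 1)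

⊆-∷ʳ⁻ : ∀ {A : Set} {xs : List A} ys {v} → xs ⊆ ys ∷ʳ v → xs ⊆ ys ⊎ ∃ λ xs′ → xs ≡ xs′ ∷ʳ v × xs′ ⊆ ys
⊆-∷ʳ⁻ [] (skip _ [])     = inj₁ []
⊆-∷ʳ⁻ [] (refl ∷ [])     = inj₂ ([] , refl , [])
⊆-∷ʳ⁻ (y ∷ ys) (skip _ τ) with ⊆-∷ʳ⁻ ys τ
... | inj₁ τ′              = inj₁ (skip y τ′)
... | inj₂ (xs′ , eq , τ′) = inj₂ (xs′ , eq , skip y τ′)
⊆-∷ʳ⁻ (y ∷ ys) (x≡y ∷ τ) with ⊆-∷ʳ⁻ ys τ
... | inj₁ τ′                = inj₁ (x≡y ∷ τ′)
... | inj₂ (xs′ , refl , τ′) = inj₂ (_ ∷ xs′ , refl , x≡y ∷ τ′)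

pair-∷ʳ⁻ : ∀ {u w : ℕ} y {v} → u ∷ w ∷ [] ⊆ y ∷ʳ v → u ∷ w ∷ [] ⊆ y ⊎ (u ∈ y × w ≡ v)
pair-∷ʳ⁻ y τ with ⊆-∷ʳ⁻ y τ
... | inj₁ τ′                        = inj₁ τ′
... | inj₂ (_ ∷ [] , refl , τ′)      = inj₂ (to∈ τ′ , refl)
... | inj₂ ([] , () , _)
... | inj₂ (_ ∷ _ ∷ [] , () , _)
... | inj₂ (_ ∷ _ ∷ _ ∷ _ , () , _)

keep-∷ʳ : ∀ {xs ys : List ℕ} {v} → xs ⊆ ys → xs ∷ʳ v ⊆ ys ∷ʳ v
keep-∷ʳ τ = ++⁺ τ ⊆-refl

skip-∷ʳ : ∀ {xs ys : List ℕ} {v} → xs ⊆ ys → xs ⊆ ys ∷ʳ v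
skip-∷ʳ {v = v} τ = ++⁺ʳ [ v ] τ

ascent : ℕ → ℕ → ℕ
ascent x y = if x <ᵇ y then 1 else 0

ascent-< : ∀ {x y} → x < y → ascent x y ≡ 1
ascent-< {x} {y} x<y with x <ᵇ y | <⇒<ᵇ x<y
... | true | _ = refl

ascent-≥ : ∀ {x y} → y ≤ x → ascent x y ≡ 0
ascent-≥ {x} {y} y≤x with x <ᵇ y | <ᵇ⇒< x y
... | false | _   = refl
... | true  | x<y = ⊥-elim (<⇒≱ (x<y tt) y≤x)

Last : ℕ → List ℕ → Set
Last ℓ y = ∃ λ y′ → y ≡ y′ ∷ʳ ℓ

last-∷ʳ : ∀ {y v} → Last v (y ∷ʳ v)
last-∷ʳ = _ , refl

asc-∷ʳ : ∀ {ℓ y} v → Last ℓ y → asc (y ∷ʳ v) ≡ asc y + ascent ℓ v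
asc-∷ʳ v ([] , refl)     = +-identityʳ _
asc-∷ʳ v (x ∷ xs , refl) = ascFrom-∷ʳ x xs
  where
  ascFrom-∷ʳ : ∀ x xs {ℓ} → ascFrom x ((xs ∷ʳ ℓ) ∷ʳ v) ≡ ascFrom x (xs ∷ʳ ℓ) + ascent ℓ v
  ascFrom-∷ʳ x []       {ℓ} = begin
    ascent x ℓ + (ascent ℓ v + 0) ≡⟨ cong (ascent x ℓ +_) (+-identityʳ _) ⟩
    ascent x ℓ + ascent ℓ v       ≡⟨ cong (_+ ascent ℓ v) (+-identityʳ _) ⟨
    ascent x ℓ + 0 + ascent ℓ v   ∎
  ascFrom-∷ʳ x (y ∷ ys) = trans (cong (ascent x y +_) (ascFrom-∷ʳ y ys)) (sym (+-assoc (ascent x y) _ _))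

asc-∷ʳ-zero : ∀ y → asc (y ∷ʳ 0) ≡ asc y
asc-∷ʳ-zero []       = refl
asc-∷ʳ-zero (x ∷ xs) = ascFrom-∷ʳ-zero x xs
  where
  ascFrom-∷ʳ-zero : ∀ x xs → ascFrom x (xs ∷ʳ 0) ≡ ascFrom x xs
  ascFrom-∷ʳ-zero x []       = refl
  ascFrom-∷ʳ-zero x (y ∷ ys) = cong (ascent x y +_) (ascFrom-∷ʳ-zero y ys)

asc-∷ʳ-< : ∀ {ℓ y v} → Last ℓ y → ℓ < v → asc (y ∷ʳ v) ≡ suc (asc y)
asc-∷ʳ-< {ℓ} {y} {v} last ℓ<v = begin
  asc (y ∷ʳ v)         ≡⟨ asc-∷ʳ v last ⟩
  asc y + ascent ℓ v   ≡⟨ cong (asc y +_) (ascent-< ℓ<v) ⟩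
  asc y + 1            ≡⟨ +-comm (asc y) 1 ⟩
  suc (asc y)          ∎

asc-∷ʳ-≥ : ∀ {ℓ y v} → Last ℓ y → v ≤ ℓ → asc (y ∷ʳ v) ≡ asc y
asc-∷ʳ-≥ {ℓ} {y} {v} last v≤ℓ = begin
  asc (y ∷ʳ v)         ≡⟨ asc-∷ʳ v last ⟩
  asc y + ascent ℓ v   ≡⟨ cong (asc y +_) (ascent-≥ v≤ℓ) ⟩
  asc y + 0            ≡⟨ +-identityʳ (asc y) ⟩
  asc y                ∎

Completes : List ℕ → List ℕ → ℕ → Set
Completes p y v = ∃ λ s → s ⊆ y × red (s ∷ʳ v) ≡ p

completes-shape : ∀ {p y v} → length p ≡ 4 → Completes p y v →
                  ∃₂ λ a b → ∃ λ c → a ∷ b ∷ c ∷ [] ⊆ y × red (a ∷ b ∷ c ∷ v ∷ []) ≡ p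
completes-shape {p} {v = v} len (s , τ , eq) = three s length-s τ eq
  where
  length-s : length s ≡ 3
  length-s = suc-injective (begin
    suc (length s)        ≡⟨ length-∷ʳ s ⟨
    length (s ∷ʳ v)       ≡⟨ length-map _ (s ∷ʳ v) ⟨
    length (red (s ∷ʳ v)) ≡⟨ cong length eq ⟩
    length p              ≡⟨ len ⟩
    4                     ∎)

  three : ∀ {y} s → length s ≡ 3 → s ⊆ y → red (s ∷ʳ v) ≡ p →
          ∃₂ λ a b → ∃ λ c → a ∷ b ∷ c ∷ [] ⊆ y × red (a ∷ b ∷ c ∷ v ∷ []) ≡ p
  three (a ∷ b ∷ c ∷ []) _ τ eq = a , b , c , τ , eq

module _ {y : List ℕ} {v : ℕ} where

  completes-0101⁻ : Completes p0101 y v → ∃ λ a → a < v × a ∷ v ∷ a ∷ [] ⊆ y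
  completes-0101⁻ c with a , b , c′ , τ , eq ← completes-shape refl c
                    with refl , refl , a<b ← red-0101⁻ {a} {b} {c′} {v} eq = a , a<b , τ

  completes-0102⁻ : Completes p0102 y v → ∃₂ λ a b → a < b × b < v × a ∷ b ∷ a ∷ [] ⊆ y
  completes-0102⁻ c with a , b , c′ , τ , eq ← completes-shape refl c
                    with refl , a<b , b<v ← red-0102⁻ {a} {b} {c′} {v} eq = a , b , a<b , b<v , τ

  completes-0112⁻ : Completes p0112 y v → ∃₂ λ a b → a < b × b < v × a ∷ b ∷ b ∷ [] ⊆ y
  completes-0112⁻ c with a , b , c′ , τ , eq ← completes-shape refl c
                    with refl , a<b , b<v ← red-0112⁻ {a} {b} {c′} {v} eq = a , b , a<b , b<v , τ

  completes-0120⁻ : Completes p0120 y v → ∃₂ λ b c → v < b × b < c × v ∷ b ∷ c ∷ [] ⊆ y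
  completes-0120⁻ c with a , b , c′ , τ , eq ← completes-shape refl c
                    with refl , v<b , b<c ← red-0120⁻ {a} {b} {c′} {v} eq = b , c′ , v<b , b<c , τ

  completes-0121⁻ : Completes p0121 y v → ∃₂ λ a c → a < v × v < c × a ∷ v ∷ c ∷ [] ⊆ y
  completes-0121⁻ c with a , b , c′ , τ , eq ← completes-shape refl c
                    with refl , a<v , v<c ← red-0121⁻ {a} {b} {c′} {v} eq = a , c′ , a<v , v<c , τ

  -- Each witness is the image of the pattern under stretch, which red does not see.
  completes-0101⁺ : ∀ {a} → a < v → a ∷ v ∷ a ∷ [] ⊆ y → Completes p0101 y v
  completes-0101⁺ a<v τ = _ , τ , red-map (stretch-mono a<v (n<1+n v)) p0101

  completes-0102⁺ : ∀ {a b} → a < b → b < v → a ∷ b ∷ a ∷ [] ⊆ y → Completes p0102 y v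
  completes-0102⁺ a<b b<v τ = _ , τ , red-map (stretch-mono a<b b<v) p0102

  completes-0112⁺ : ∀ {a b} → a < b → b < v → a ∷ b ∷ b ∷ [] ⊆ y → Completes p0112 y v
  completes-0112⁺ a<b b<v τ = _ , τ , red-map (stretch-mono a<b b<v) p0112

  completes-0120⁺ : ∀ {b c} → v < b → b < c → v ∷ b ∷ c ∷ [] ⊆ y → Completes p0120 y v
  completes-0120⁺ v<b b<c τ = _ , τ , red-map (stretch-mono v<b b<c) p0120

  completes-0121⁺ : ∀ {a c} → a < v → v < c → a ∷ v ∷ c ∷ [] ⊆ y → Completes p0121 y v
  completes-0121⁺ a<v v<c τ = _ , τ , red-map (stretch-mono a<v v<c) p0121

-- Every letter of ys is at most one more than the number of ascents before it, in a word
-- that continues a prefix with n ascents ending in x.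
AscentBounded : ℕ → ℕ → List ℕ → Set
AscentBounded n x []       = ⊤
AscentBounded n x (y ∷ ys) = y ≤ suc n × AscentBounded (n + ascent x y) y ys

private
  Lookup : ℕ → ℕ → List ℕ → Set
  Lookup n x ys = ∀ (i : Fin (length ys)) → lookup ys i ≤ suc (n + ascFrom x (take (toℕ i) ys))

  fromLookup : ∀ n x ys → Lookup n x ys → AscentBounded n x ys
  fromLookup n x []       _ = tt
  fromLookup n x (y ∷ ys) h =
    subst (y ≤_) (cong suc (+-identityʳ n)) (h fzero) ,
    fromLookup _ y ys λ i → subst (lookup ys i ≤_) (cong suc (sym (+-assoc n (ascent x y) _))) (h (fsuc i))

  toLookup : ∀ n x ys → AscentBounded n x ys → Lookup n x ys
  toLookup n x (y ∷ ys) (y≤ , _)  fzero    = subst (y ≤_) (cong suc (sym (+-identityʳ n))) y≤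
  toLookup n x (y ∷ ys) (_ , ys≤) (fsuc i) =
    subst (lookup ys i ≤_) (cong suc (+-assoc n (ascent x y) _)) (toLookup _ y ys ys≤ i)

isAscentSeq⁻ : ∀ {x xs} → IsAscentSeq (x ∷ xs) → x ≡ 0 × AscentBounded 0 x xs
isAscentSeq⁻ {x} {xs} a = IsAscentSeq.first a fzero refl , fromLookup 0 x xs λ i → IsAscentSeq.bound a (fsuc i) λ ()

isAscentSeq⁺ : ∀ {xs} → AscentBounded 0 0 xs → IsAscentSeq (0 ∷ xs)
isAscentSeq⁺ {xs} bounded = record { first = first ; bound = bound }
  where
  first : ∀ (i : Fin (length (0 ∷ xs))) → toℕ i ≡ 0 → lookup (0 ∷ xs) i ≡ 0
  first fzero _ = refl
  bound : ∀ (i : Fin (length (0 ∷ xs))) → toℕ i ≢ 0 → lookup (0 ∷ xs) i ≤ suc (asc (take (toℕ i) (0 ∷ xs)))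
  bound fzero    i≢0 = ⊥-elim (i≢0 refl)
  bound (fsuc i) _   = toLookup 0 0 xs bounded i

AscentBounded-∷ʳ⁻ : ∀ n x ys {v} → AscentBounded n x (ys ∷ʳ v) → AscentBounded n x ys × v ≤ suc (n + ascFrom x ys)
AscentBounded-∷ʳ⁻ n x [] {v} (v≤ , _)   = tt , subst (v ≤_) (cong suc (sym (+-identityʳ n))) v≤
AscentBounded-∷ʳ⁻ n x (y ∷ ys) {v} (y≤ , ys≤) =
  let ys≤′ , v≤ = AscentBounded-∷ʳ⁻ _ y ys ys≤
  in (y≤ , ys≤′) , subst (v ≤_) (cong suc (+-assoc n (ascent x y) _)) v≤

AscentBounded-∷ʳ⁺ : ∀ n x ys {v} → AscentBounded n x ys → v ≤ suc (n + ascFrom x ys) → AscentBounded n x (ys ∷ʳ v)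
AscentBounded-∷ʳ⁺ n x [] {v} _          v≤ = subst (v ≤_) (cong suc (+-identityʳ n)) v≤ , tt
AscentBounded-∷ʳ⁺ n x (y ∷ ys) {v} (y≤ , ys≤) v≤ =
  y≤ , AscentBounded-∷ʳ⁺ _ y ys ys≤ (subst (v ≤_) (cong suc (sym (+-assoc n (ascent x y) _))) v≤)

isAscentSeq-∷ʳ⁻ : ∀ {x xs v} → IsAscentSeq ((x ∷ xs) ∷ʳ v) → IsAscentSeq (x ∷ xs) × v ≤ suc (asc (x ∷ xs))
isAscentSeq-∷ʳ⁻ {x} {xs} a with refl , bounded ← isAscentSeq⁻ a =
  let bounded′ , v≤ = AscentBounded-∷ʳ⁻ 0 0 xs bounded in isAscentSeq⁺ bounded′ , v≤

isAscentSeq-∷ʳ⁺ : ∀ {x xs v} → IsAscentSeq (x ∷ xs) → v ≤ suc (asc (x ∷ xs)) → IsAscentSeq ((x ∷ xs) ∷ʳ v)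
isAscentSeq-∷ʳ⁺ {x} {xs} a v≤ with refl , bounded ← isAscentSeq⁻ a = isAscentSeq⁺ (AscentBounded-∷ʳ⁺ 0 0 xs bounded v≤)

Admissible : List (List ℕ) → List ℕ → ℕ → Set
Admissible P y v = v ≤ suc (asc y) × All (λ p → ¬ Completes p y v) P

avoids-∷ʳ⁺ : ∀ {y v p} → Avoids y p → ¬ Completes p y v → Avoids (y ∷ʳ v) p
avoids-∷ʳ⁺ {y} avoids incomplete (s , τ , eq) with ⊆-∷ʳ⁻ y τ
... | inj₁ τ′               = avoids (s , τ′ , eq)
... | inj₂ (s′ , refl , τ′) = incomplete (s′ , τ′ , eq)

avoids-∷ʳ⁻ : ∀ {y v p} → Avoids (y ∷ʳ v) p → Avoids y p × ¬ Completes p y v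
avoids-∷ʳ⁻ avoids = (λ (s , τ , eq) → avoids (s , skip-∷ʳ τ , eq)) , (λ (s , τ , eq) → avoids (s ∷ʳ _ , keep-∷ʳ τ , eq))

short-avoids : ∀ {y p} → length y < length p → Avoids y p
short-avoids {y} {p} y<p (s , τ , eq) =
  <⇒≱ y<p (subst (_≤ length y) (trans (sym (length-map _ s)) (cong length eq)) (length-mono-≤ τ))

InA-∷ʳ⁺ : ∀ {P n y v} → InA P (suc n) y → Admissible P y v → InA P (suc (suc n)) (y ∷ʳ v)
InA-∷ʳ⁺ {y = []}     (() , _)
InA-∷ʳ⁺ {y = x ∷ xs} (len , ascent-seq , avoids) (v≤ , incomplete) =
  trans (length-∷ʳ (x ∷ xs)) (cong suc len) ,
  isAscentSeq-∷ʳ⁺ ascent-seq v≤ ,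
  All.zipWith (λ (a , i) → avoids-∷ʳ⁺ a i) (avoids , incomplete)

InA-∷ʳ⁻ : ∀ {P n y v} → InA P (suc (suc n)) (y ∷ʳ v) → InA P (suc n) y × Admissible P y v
InA-∷ʳ⁻ {y = []}     (() , _)
InA-∷ʳ⁻ {y = x ∷ xs} (len , ascent-seq , avoids) =
  let ascent-seq′ , v≤ = isAscentSeq-∷ʳ⁻ ascent-seq in
  (suc-injective (trans (sym (length-∷ʳ (x ∷ xs))) len) , ascent-seq′ , All.map (proj₁ ∘ avoids-∷ʳ⁻) avoids) ,
  v≤ , All.map (proj₂ ∘ avoids-∷ʳ⁻) avoids

-- Generating trees

record Edge (Class : Set) : Set where
  constructor edge
  field
    target  : Class
    ascents : ℕ
    letter  : ℕ

-- A node is a word y with a class c and a label k, which is the number of ascents of y in the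
-- trees below; its children are the words y ∷ʳ letter e for e ∈ edges c k, and size c m counts
-- the descendants of a node of class c after m generations.
record GeneratingTree (P : List (List ℕ)) : Set₁ where
  field
    Class           : Set
    root            : Class
    edges           : Class → ℕ → List (Edge Class)
    Inv             : Class → ℕ → List ℕ → Set
    patterns-long   : All (λ p → 1 < length p) P
    inv-root        : Inv root 0 (0 ∷ [])
    inv-edge        : ∀ {c k y e} → Inv c k y → e ∈ edges c k →
                      Inv (Edge.target e) (Edge.ascents e) (y ∷ʳ Edge.letter e)
    edge-admissible : ∀ {c k y e} → Inv c k y → e ∈ edges c k → Admissible P y (Edge.letter e)
    admissible-edge : ∀ {c k y v} → Inv c k y → Admissible P y v → v ∈ map Edge.letter (edges c k)
    letters-unique  : ∀ {c k y} → Inv c k y → Unique (map Edge.letter (edges c k))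
    size            : Class → ℕ → ℕ
    size-zero       : ∀ c → size c 0 ≡ 1
    size-suc        : ∀ c k m → size c (suc m) ≡ sum (map (λ e → size (Edge.target e) m) (edges c k))

module Enumeration {P} (T : GeneratingTree P) where

  open GeneratingTree T
  open Edge using (target; letter)

  record Node : Set where
    constructor node
    field
      class   : Class
      ascents : ℕ
      word    : List ℕ

  open Node

  Valid : Node → Set
  Valid x = Inv (class x) (ascents x) (word x)

  child : Node → Edge Class → Node
  child x e = node (target e) (Edge.ascents e) (word x ∷ʳ letter e)

  children : Node → List Node
  children x = map (child x) (edges (class x) (ascents x))

  level : ℕ → List Node
  level zero    = node root 0 (0 ∷ []) ∷ []
  level (suc n) = concatMap children (level n)

  ∈-level⁻ : ∀ {n x} → x ∈ level (suc n) →
             ∃₂ λ p e → p ∈ level n × e ∈ edges (class p) (ascents p) × x ≡ child p e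
  ∈-level⁻ {n} x∈ with p , p∈ , x∈children ← find (∈-concatMap⁻ children {level n} x∈)
               with e , e∈ , refl ← ∈-map⁻ (child p) x∈children = p , e , p∈ , e∈ , refl

  ∈-level⁺ : ∀ {n p e} → p ∈ level n → e ∈ edges (class p) (ascents p) → child p e ∈ level (suc n)
  ∈-level⁺ {n} {p} p∈ e∈ = ∈-concatMap⁺ children {level n} (lose p∈ (∈-map⁺ (child p) e∈))

  level-sound : ∀ n {x} → x ∈ level n → Valid x × InA P (suc n) (word x)
  level-sound zero (here refl) = inv-root , (refl , isAscentSeq⁺ tt , All.map short-avoids patterns-long)
  level-sound (suc n) x∈ with p , e , p∈ , e∈ , refl ← ∈-level⁻ {n} x∈ =
    let valid , inA = level-sound n p∈ in inv-edge valid e∈ , InA-∷ʳ⁺ inA (edge-admissible valid e∈)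

  level-complete : ∀ n {x} → InA P (suc n) x → ∃ λ p → p ∈ level n × word p ≡ x
  level-complete zero {[]}         (() , _)
  level-complete zero {_ ∷ _ ∷ _}  (() , _)
  level-complete zero {x ∷ []}     (_ , ascent-seq , _) with refl , _ ← isAscentSeq⁻ ascent-seq = _ , here refl , refl
  level-complete (suc n) {x} inA with initLast x
  ... | []      = ⊥-elim (0≢1+n (proj₁ inA))
  ... | y ∷ʳ′ v with inA-y , admissible ← InA-∷ʳ⁻ inA
                with p , p∈ , refl ← level-complete n inA-y
                with e , e∈ , refl ← ∈-map⁻ letter (admissible-edge (proj₁ (level-sound n p∈)) admissible)
                = child p e , ∈-level⁺ {n} p∈ e∈ , refl

  private
    words-children : ∀ x → map word (children x) ≡ map (word x ∷ʳ_) (map letter (edges (class x) (ascents x)))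
    words-children x = trans (sym (map-∘ (edges (class x) (ascents x)))) (map-∘ (edges (class x) (ascents x)))

    children-unique : ∀ {x} → Valid x → Unique (map word (children x))
    children-unique {x} valid =
      subst Unique (sym (words-children x)) (Unique.map⁺ (∷ʳ-injectiveʳ (word x) (word x)) (letters-unique valid))

    children-disjoint : ∀ {x x′} → word x ≢ word x′ → Disjoint (map word (children x)) (map word (children x′))
    children-disjoint {x} {x′} x≢x′ (z∈ , z∈′)
      with _ , _ , refl ← ∈-map⁻ (word x ∷ʳ_) (subst (_ ∈_) (words-children x) z∈)
      with _ , _ , eq   ← ∈-map⁻ (word x′ ∷ʳ_) (subst (_ ∈_) (words-children x′) z∈′)
      = x≢x′ (∷ʳ-injectiveˡ (word x) (word x′) eq)

  level-unique : ∀ n → Unique (map word (level n))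
  level-unique zero    = [] ∷ []
  level-unique (suc n) = subst Unique (sym (map-concatMap word children (level n)))
    (Unique.concat⁺ (All.map⁺ (All.tabulate λ x∈ → children-unique (proj₁ (level-sound n x∈))))
                    (AllPairs.map⁺ (AllPairs.map children-disjoint (AllPairs.map⁻ (level-unique n)))))

  private
    weight : ℕ → Node → ℕ
    weight m x = size (class x) m

    weight-zero : ∀ xs → sum (map (weight 0) xs) ≡ length xs
    weight-zero []       = refl
    weight-zero (x ∷ xs) = cong₂ _+_ (size-zero (class x)) (weight-zero xs)

    weight-children : ∀ m x → sum (map (weight m) (children x)) ≡ weight (suc m) x
    weight-children m x = trans (cong sum (sym (map-∘ (edges (class x) (ascents x))))) (sym (size-suc (class x) (ascents x) m))

    weight-concatMap : ∀ m xs → sum (map (weight m) (concatMap children xs)) ≡ sum (map (weight (suc m)) xs)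
    weight-concatMap m []       = refl
    weight-concatMap m (x ∷ xs) = begin
      sum (map (weight m) (children x ++ concatMap children xs))                   ≡⟨ cong sum (map-++ (weight m) (children x) _) ⟩
      sum (map (weight m) (children x) ++ map (weight m) (concatMap children xs))  ≡⟨ sum-++ (map (weight m) (children x)) _ ⟩
      sum (map (weight m) (children x)) + sum (map (weight m) (concatMap children xs))
        ≡⟨ cong₂ _+_ (weight-children m x) (weight-concatMap m xs) ⟩
      weight (suc m) x + sum (map (weight (suc m)) xs)                             ∎

    weight-level : ∀ m n → sum (map (weight m) (level n)) ≡ length (level (m + n))
    weight-level zero    n = weight-zero (level n)
    weight-level (suc m) n = begin
      sum (map (weight (suc m)) (level n))  ≡⟨ weight-concatMap m (level n) ⟨
      sum (map (weight m) (level (suc n)))  ≡⟨ weight-level m (suc n) ⟩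
      length (level (m + suc n))            ≡⟨ cong (length ∘ level) (+-suc m n) ⟩
      length (level (suc m + n))            ∎

  length-level : ∀ m → length (level m) ≡ size root m
  length-level m = begin
    length (level m)        ≡⟨ cong (length ∘ level) (+-identityʳ m) ⟨
    length (level (m + 0))  ≡⟨ weight-level m 0 ⟨
    size root m + 0         ≡⟨ +-identityʳ _ ⟩
    size root m             ∎

enumerate : ∀ {P} (T : GeneratingTree P) m → HasCount P (suc m) (GeneratingTree.size T (GeneratingTree.root T) m)
enumerate T m =
  map word (level m) , level-unique m , (λ x → mk⇔ (sound x) (complete x)) ,
  trans (length-map word (level m)) (length-level m)
  where
  open Enumeration T
  open Node
  sound : ∀ x → x ∈ map word (level m) → InA _ (suc m) x
  sound x x∈ with p , p∈ , refl ← ∈-map⁻ word x∈ = proj₂ (level-sound m p∈)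
  complete : ∀ x → InA _ (suc m) x → x ∈ map word (level m)
  complete x inA with p , p∈ , refl ← level-complete m inA = ∈-map⁺ word p∈

record InversionTops (R : ℕ → Set) (y : List ℕ) : Set where
  constructor mkTops
  field top : ∀ {u w} → u ∷ w ∷ [] ⊆ y → w < u → R u

record Repeats (R : ℕ → Set) (y : List ℕ) : Set where
  constructor mkRepeats
  field repeated : ∀ {b} → b ∷ b ∷ [] ⊆ y → R b

open InversionTops
open Repeats

Climbs : ℕ → List ℕ → Set
Climbs k y = ∀ {u w} → u < w → w < k → u ∷ w ∷ k ∷ [] ⊆ y

module _ {R : ℕ → Set} {y : List ℕ} where

  tops-map : ∀ {R′ : ℕ → Set} → (∀ {u} → R u → R′ u) → InversionTops R y → InversionTops R′ y
  tops-map f t = mkTops λ τ w<u → f (top t τ w<u)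

  repeats-map : ∀ {R′ : ℕ → Set} → (∀ {b} → R b → R′ b) → Repeats R y → Repeats R′ y
  repeats-map f r = mkRepeats λ τ → f (repeated r τ)

  tops-∷ʳ : ∀ {v} → InversionTops R y → (∀ {u} → u ∈ y → v < u → R u) → InversionTops R (y ∷ʳ v)
  tops-∷ʳ t new = mkTops λ τ w<u → case pair-∷ʳ⁻ y τ of λ where
    (inj₁ τ′)          → top t τ′ w<u
    (inj₂ (u∈y , refl)) → new u∈y w<u

  repeats-∷ʳ : ∀ {v} → Repeats R y → (v ∈ y → R v) → Repeats R (y ∷ʳ v)
  repeats-∷ʳ r new = mkRepeats λ τ → case pair-∷ʳ⁻ y τ of λ where
    (inj₁ τ′)          → repeated r τ′
    (inj₂ (b∈y , refl)) → new b∈y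

  tops-∷ʳ-max : ∀ {v} → InversionTops R y → All (_≤ v) y → InversionTops R (y ∷ʳ v)
  tops-∷ʳ-max t bounded = tops-∷ʳ t λ u∈y v<u → ⊥-elim (<⇒≱ v<u (All.lookup bounded u∈y))

climbs-∷ʳ : ∀ {k y v} → Climbs k y → Climbs k (y ∷ʳ v)
climbs-∷ʳ climbs u<w w<k = skip-∷ʳ (climbs u<w w<k)

first-two : ∀ {a b c : ℕ} {y} → a ∷ b ∷ c ∷ [] ⊆ y → a ∷ b ∷ [] ⊆ y
first-two τ = ⊆-trans (refl ∷ refl ∷ minimum _) τ

k∸1<k : ∀ {k} → 1 ≤ k → k ∸ 1 < k
k∸1<k (s≤s _) = ≤-refl

-- 0ᵃ 1 2 ⋯ k for R = ∅, and 0ᵃ 1 0ᶜ 2 ⋯ k for R = (_≡ 1)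
record Staircase (R : ℕ → Set) (k : ℕ) (y : List ℕ) : Set where
  field
    bounded : All (_≤ k) y
    covers  : ∀ {u} → u ≤ k → u ∈ y
    pairs   : ∀ {u w} → u < w → w ≤ k → u ∷ w ∷ [] ⊆ y
    climbs  : Climbs k y
    tops    : InversionTops R y
    repeats : Repeats (_≡ 0) y
    ascents : asc y ≡ k

-- a staircase followed by kᵇ, b ≥ 1
record Plateau (R : ℕ → Set) (k : ℕ) (y : List ℕ) : Set where
  field
    positive  : 1 ≤ k
    bounded   : All (_≤ k) y
    climbs    : Climbs k y
    tops      : InversionTops R y
    repeats   : Repeats (λ b → b ≡ 0 ⊎ b ≡ k) y
    0∷k∷k⊆y   : 0 ∷ k ∷ k ∷ [] ⊆ y
    k∸1∷k⊆y   : k ∸ 1 ∷ k ∷ [] ⊆ y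
    ascents   : asc y ≡ k

-- 0ᵃ 1 ⋯ k kᵇ 0ᶜ, c ≥ 1
record Valley (k : ℕ) (y : List ℕ) : Set where
  field
    positive : 1 ≤ k
    bounded  : All (_≤ k) y
    climbs   : Climbs k y
    0∷k∷0⊆y  : 0 ∷ k ∷ 0 ∷ [] ⊆ y
    ascents  : asc y ≡ k

-- 0ᵃ 1 ⋯ k kᵇ (k − 1)ᶜ, c ≥ 1
record StepDown (k : ℕ) (y : List ℕ) : Set where
  field
    positive      : 1 ≤ k
    bounded       : All (_≤ k) y
    climbs        : Climbs k y
    tops          : InversionTops (_≡ k) y
    repeats       : Repeats (λ b → b ≡ 0 ⊎ b ≡ k ⊎ b ≡ k ∸ 1) y
    k∸1∷k∷k∸1⊆y   : k ∸ 1 ∷ k ∷ k ∸ 1 ∷ [] ⊆ y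
    ascents       : asc y ≡ k

module _ {R : ℕ → Set} {k : ℕ} {y : List ℕ} where

  staircase-up : ∀ {ℓ} → Staircase R k y → Last ℓ y → ℓ ≤ k → Staircase R (suc k) (y ∷ʳ suc k)
  staircase-up s last ℓ≤k = record
    { bounded = All.∷ʳ⁺ (All.map m≤n⇒m≤1+n bounded) ≤-refl
    ; covers  = covers′
    ; pairs   = pairs′
    ; climbs  = λ u<w w<1+k → keep-∷ʳ (pairs u<w (s≤s⁻¹ w<1+k))
    ; tops    = tops-∷ʳ-max tops (All.map m≤n⇒m≤1+n bounded)
    ; repeats = repeats-∷ʳ repeats λ 1+k∈y → ⊥-elim (1+n≰n (All.lookup bounded 1+k∈y))
    ; ascents = trans (asc-∷ʳ-< last (s≤s ℓ≤k)) (cong suc ascents)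
    }
    where
    open Staircase s
    covers′ : ∀ {u} → u ≤ suc k → u ∈ y ∷ʳ suc k
    covers′ u≤1+k with m≤n⇒m<n∨m≡n u≤1+k
    ... | inj₁ u<1+k = ∈-++⁺ˡ (covers (s≤s⁻¹ u<1+k))
    ... | inj₂ refl  = ∈-++⁺ʳ y (here refl)
    pairs′ : ∀ {u w} → u < w → w ≤ suc k → u ∷ w ∷ [] ⊆ y ∷ʳ suc k
    pairs′ u<w w≤1+k with m≤n⇒m<n∨m≡n w≤1+k
    ... | inj₁ w<1+k = skip-∷ʳ (pairs u<w (s≤s⁻¹ w<1+k))
    ... | inj₂ refl  = keep-∷ʳ (from∈ (covers (s≤s⁻¹ u<w)))

  staircase-∷ʳ-zero : ∀ {R′ : ℕ → Set} → Staircase R k y → (∀ {u} → R u → R′ u) →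
                      (∀ {u} → u ∈ y → 0 < u → R′ u) → Staircase R′ k (y ∷ʳ 0)
  staircase-∷ʳ-zero s R⇒R′ new = record
    { bounded = All.∷ʳ⁺ bounded z≤n
    ; covers  = λ u≤k → ∈-++⁺ˡ (covers u≤k)
    ; pairs   = λ u<w w≤k → skip-∷ʳ (pairs u<w w≤k)
    ; climbs  = climbs-∷ʳ climbs
    ; tops    = tops-∷ʳ (tops-map R⇒R′ tops) new
    ; repeats = repeats-∷ʳ repeats λ _ → refl
    ; ascents = trans (asc-∷ʳ-zero y) ascents
    }
    where open Staircase s

  staircase-plateau : Staircase R k y → 1 ≤ k → Last k y → Plateau R k (y ∷ʳ k)
  staircase-plateau s 1≤k last = record
    { positive = 1≤k
    ; bounded  = All.∷ʳ⁺ bounded ≤-refl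
    ; climbs   = climbs-∷ʳ climbs
    ; tops     = tops-∷ʳ-max tops bounded
    ; repeats  = repeats-∷ʳ (repeats-map inj₁ repeats) λ _ → inj₂ refl
    ; 0∷k∷k⊆y  = keep-∷ʳ (pairs 1≤k ≤-refl)
    ; k∸1∷k⊆y  = skip-∷ʳ (pairs (k∸1<k 1≤k) ≤-refl)
    ; ascents  = trans (asc-∷ʳ-≥ last ≤-refl) ascents
    }
    where open Staircase s

  staircase-valley : Staircase R k y → 1 ≤ k → Valley k (y ∷ʳ 0)
  staircase-valley s 1≤k = record
    { positive = 1≤k
    ; bounded  = All.∷ʳ⁺ bounded z≤n
    ; climbs   = climbs-∷ʳ climbs
    ; 0∷k∷0⊆y  = keep-∷ʳ (pairs 1≤k ≤-refl)
    ; ascents  = trans (asc-∷ʳ-zero y) ascents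
    }
    where open Staircase s

  plateau-extend : Plateau R k y → Last k y → Plateau R k (y ∷ʳ k)
  plateau-extend p last = record
    { positive = positive
    ; bounded  = All.∷ʳ⁺ bounded ≤-refl
    ; climbs   = climbs-∷ʳ climbs
    ; tops     = tops-∷ʳ-max tops bounded
    ; repeats  = repeats-∷ʳ repeats λ _ → inj₂ refl
    ; 0∷k∷k⊆y  = skip-∷ʳ 0∷k∷k⊆y
    ; k∸1∷k⊆y  = skip-∷ʳ k∸1∷k⊆y
    ; ascents  = trans (asc-∷ʳ-≥ last ≤-refl) ascents
    }
    where open Plateau p

  plateau-valley : Plateau R k y → Valley k (y ∷ʳ 0)
  plateau-valley p = record
    { positive = positive
    ; bounded  = All.∷ʳ⁺ bounded z≤n
    ; climbs   = climbs-∷ʳ climbs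
    ; 0∷k∷0⊆y  = keep-∷ʳ (first-two 0∷k∷k⊆y)
    ; ascents  = trans (asc-∷ʳ-zero y) ascents
    }
    where open Plateau p

module _ {k : ℕ} {y : List ℕ} where

  valley-extend : Valley k y → Valley k (y ∷ʳ 0)
  valley-extend v = record
    { positive = positive
    ; bounded  = All.∷ʳ⁺ bounded z≤n
    ; climbs   = climbs-∷ʳ climbs
    ; 0∷k∷0⊆y  = skip-∷ʳ 0∷k∷0⊆y
    ; ascents  = trans (asc-∷ʳ-zero y) ascents
    }
    where open Valley v

  private
    new-top : All (_≤ k) y → ∀ {u} → u ∈ y → k ∸ 1 < u → u ≡ k
    new-top bounded u∈y k∸1<u = ≤-antisym (All.lookup bounded u∈y) (≤-trans (m≤n+m∸n k 1) k∸1<u)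

  staircase-stepDown : Staircase ∅ k y → 1 ≤ k → Last k y → StepDown k (y ∷ʳ (k ∸ 1))
  staircase-stepDown s 1≤k last = record
    { positive    = 1≤k
    ; bounded     = All.∷ʳ⁺ bounded (m∸n≤m k 1)
    ; climbs      = climbs-∷ʳ climbs
    ; tops        = tops-∷ʳ (tops-map ⊥-elim tops) (new-top bounded)
    ; repeats     = repeats-∷ʳ (repeats-map inj₁ repeats) λ _ → inj₂ (inj₂ refl)
    ; k∸1∷k∷k∸1⊆y = keep-∷ʳ (pairs (k∸1<k 1≤k) ≤-refl)
    ; ascents     = trans (asc-∷ʳ-≥ last (m∸n≤m k 1)) ascents
    }
    where open Staircase s

  plateau-stepDown : Plateau ∅ k y → Last k y → StepDown k (y ∷ʳ (k ∸ 1))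
  plateau-stepDown p last = record
    { positive    = positive
    ; bounded     = All.∷ʳ⁺ bounded (m∸n≤m k 1)
    ; climbs      = climbs-∷ʳ climbs
    ; tops        = tops-∷ʳ (tops-map ⊥-elim tops) (new-top bounded)
    ; repeats     = repeats-∷ʳ (repeats-map (Sum.map₂ inj₁) repeats) λ _ → inj₂ (inj₂ refl)
    ; k∸1∷k∷k∸1⊆y = keep-∷ʳ k∸1∷k⊆y
    ; ascents     = trans (asc-∷ʳ-≥ last (m∸n≤m k 1)) ascents
    }
    where open Plateau p

  stepDown-extend : StepDown k y → Last (k ∸ 1) y → StepDown k (y ∷ʳ (k ∸ 1))
  stepDown-extend d last = record
    { positive    = positive
    ; bounded     = All.∷ʳ⁺ bounded (m∸n≤m k 1)
    ; climbs      = climbs-∷ʳ climbs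
    ; tops        = tops-∷ʳ tops (new-top bounded)
    ; repeats     = repeats-∷ʳ repeats λ _ → inj₂ (inj₂ refl)
    ; k∸1∷k∷k∸1⊆y = skip-∷ʳ k∸1∷k∷k∸1⊆y
    ; ascents     = trans (asc-∷ʳ-≥ last ≤-refl) ascents
    }
    where open StepDown d

root-staircase : Staircase ∅ 0 (0 ∷ [])
root-staircase = record
  { bounded = z≤n ∷ []
  ; covers  = λ { z≤n → here refl }
  ; pairs   = λ u<w w≤0 → ⊥-elim (n≮0 (<-≤-trans u<w w≤0))
  ; climbs  = λ _ w<0 → ⊥-elim (n≮0 w<0)
  ; tops    = mkTops λ τ _ → ⊥-elim (1+n≰n (length-mono-≤ τ))
  ; repeats = mkRepeats λ τ → ⊥-elim (1+n≰n (length-mono-≤ τ))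
  ; ascents = refl
  }

zeros-tops : ∀ {R R′ : ℕ → Set} {y} → Staircase R 0 y → ∀ {u} → u ∈ y → 0 < u → R′ u
zeros-tops s u∈y 0<u = ⊥-elim (<⇒≱ 0<u (All.lookup (Staircase.bounded s) u∈y))

module _ {y : List ℕ} where

  private
    third∈ : ∀ {a b c} → a ∷ b ∷ c ∷ [] ⊆ y → c ∈ y
    third∈ τ = to∈ (∷ˡ⁻ (∷ˡ⁻ τ))

  zero-blocks-0101 : ¬ Completes p0101 y 0
  zero-blocks-0101 c with _ , () , _ ← completes-0101⁻ c

  zero-blocks-0102 : ¬ Completes p0102 y 0
  zero-blocks-0102 c with _ , _ , _ , () , _ ← completes-0102⁻ c

  zero-blocks-0112 : ¬ Completes p0112 y 0
  zero-blocks-0112 c with _ , _ , _ , () , _ ← completes-0112⁻ c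

  zero-blocks-0121 : ¬ Completes p0121 y 0
  zero-blocks-0121 c with _ , _ , () , _ ← completes-0121⁻ c

  tops-block-0101 : ∀ {R v} → InversionTops R y → ¬ R v → ¬ Completes p0101 y v
  tops-block-0101 t ¬Rv c with _ , a<v , τ ← completes-0101⁻ c = ¬Rv (top t (∷ˡ⁻ τ) a<v)

  tops-block-0102 : ∀ {R v} → InversionTops R y → (∀ {b} → R b → v ≤ b) → ¬ Completes p0102 y v
  tops-block-0102 t v≤ c with _ , _ , a<b , b<v , τ ← completes-0102⁻ c = <⇒≱ b<v (v≤ (top t (∷ˡ⁻ τ) a<b))

  repeats-block-0112 : ∀ {R v} → Repeats R y → (∀ {b} → R b → b ≡ 0 ⊎ v ≤ b) → ¬ Completes p0112 y v
  repeats-block-0112 r R⇒ c with _ , _ , a<b , b<v , τ ← completes-0112⁻ c with R⇒ (repeated r (∷ˡ⁻ τ))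
  ... | inj₁ refl = n≮0 a<b
  ... | inj₂ v≤b  = <⇒≱ b<v v≤b

  bounded-blocks-0120 : ∀ {k v} → All (_≤ k) y → k ≤ suc v → ¬ Completes p0120 y v
  bounded-blocks-0120 bounded k≤1+v c with _ , _ , v<b , b<c , τ ← completes-0120⁻ c =
    <⇒≱ (≤-trans (s≤s v<b) b<c) (≤-trans (All.lookup bounded (third∈ τ)) k≤1+v)

  bounded-blocks-0121 : ∀ {k v} → All (_≤ k) y → k ≤ v → ¬ Completes p0121 y v
  bounded-blocks-0121 bounded k≤v c with _ , _ , _ , v<c , τ ← completes-0121⁻ c =
    <⇒≱ v<c (≤-trans (All.lookup bounded (third∈ τ)) k≤v)

  climbs-complete-0120 : ∀ {k v w} → Climbs k y → v < w → w < k → Completes p0120 y v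
  climbs-complete-0120 climbs v<w w<k = completes-0120⁺ v<w w<k (climbs v<w w<k)

  climbs-complete-0121 : ∀ {k v} → Climbs k y → 0 < v → v < k → Completes p0121 y v
  climbs-complete-0121 climbs 0<v v<k = completes-0121⁺ 0<v v<k (climbs 0<v v<k)

record Blocked (y : List ℕ) (v : ℕ) : Set where
  field
    ¬0101 : ¬ Completes p0101 y v
    ¬0102 : ¬ Completes p0102 y v
    ¬0112 : ¬ Completes p0112 y v
    ¬0120 : ¬ Completes p0120 y v
    ¬0121 : ¬ Completes p0121 y v

zero-blocked : ∀ {y} → All (_≤ 1) y → Blocked y 0
zero-blocked bounded = record
  { ¬0101 = zero-blocks-0101
  ; ¬0102 = zero-blocks-0102
  ; ¬0112 = zero-blocks-0112
  ; ¬0120 = bounded-blocks-0120 bounded ≤-refl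
  ; ¬0121 = zero-blocks-0121
  }

sorted-blocked : ∀ {y k v} → All (_≤ k) y → k ≤ v → InversionTops ∅ y → Repeats (λ b → b ≡ 0 ⊎ v ≤ b) y → Blocked y v
sorted-blocked bounded k≤v t r = record
  { ¬0101 = tops-block-0101 t λ ()
  ; ¬0102 = tops-block-0102 t λ ()
  ; ¬0112 = repeats-block-0112 r λ b≡0⊎v≤b → b≡0⊎v≤b
  ; ¬0120 = bounded-blocks-0120 bounded (m≤n⇒m≤1+n k≤v)
  ; ¬0121 = bounded-blocks-0121 bounded k≤v
  }

staircase-blocked : ∀ {y k v} → Staircase ∅ k y → k ≤ v → Blocked y v
staircase-blocked s k≤v = sorted-blocked bounded k≤v tops (repeats-map inj₁ repeats)
  where open Staircase s

plateau-blocked : ∀ {y k} → Plateau ∅ k y → Blocked y k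
plateau-blocked p = sorted-blocked bounded ≤-refl tops (repeats-map (Sum.map₂ (≤-reflexive ∘ sym)) repeats)
  where open Plateau p

zeros-blocked : ∀ {y} → Staircase ∅ 0 y → Blocked y 0
zeros-blocked s = zero-blocked (All.map (λ u≤0 → ≤-trans u≤0 z≤n) (Staircase.bounded s))

≤1+≡⁺ : ∀ {a k v} → a ≡ k → v ≤ suc k → v ≤ suc a
≤1+≡⁺ refl v≤ = v≤

≤1+≡⁻ : ∀ {a k v} → a ≡ k → v ≤ suc a → v ≤ suc k
≤1+≡⁻ refl v≤ = v≤

≤1+-cases : ∀ {v k} → v ≤ suc k → v ≡ suc k ⊎ v ≡ k ⊎ v < k
≤1+-cases v≤1+k with m≤n⇒m<n∨m≡n v≤1+k
... | inj₂ v≡1+k = inj₁ v≡1+k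
... | inj₁ (s≤s v≤k) with m≤n⇒m<n∨m≡n v≤k
... | inj₂ v≡k = inj₂ (inj₁ v≡k)
... | inj₁ v<k = inj₂ (inj₂ v<k)

≤2-cases : ∀ {v} → v ≤ 2 → v ≡ 0 ⊎ v ≡ 1 ⊎ v ≡ 2
≤2-cases z≤n             = inj₁ refl
≤2-cases (s≤s z≤n)       = inj₂ (inj₁ refl)
≤2-cases (s≤s (s≤s z≤n)) = inj₂ (inj₂ refl)

private
  pascal : ∀ n k → suc n C suc k ≡ n C k + n C suc k
  pascal n k = sym (nCk+nC[k+1]≡[n+1]C[k+1] n k)

  [1+n]C2 : ∀ n → suc n C 2 ≡ n + n C 2
  [1+n]C2 n = trans (pascal n 1) (cong (_+ n C 2) (nC1≡n n))

zeros-size-suc : ∀ m → 1 + suc (suc (suc m)) C 3 ≡ (1 + suc (suc m) C 3) + (suc (suc m) C 2 + 0)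
zeros-size-suc m = trans (cong (1 +_) (pascal (suc (suc m)) 2)) (rearrange (suc (suc m) C 2) (suc (suc m) C 3))
  where
  rearrange : ∀ x y → 1 + (x + y) ≡ (1 + y) + (x + 0)
  rearrange = solve-∀

rising-size-suc : ∀ m → suc (suc m) ≡ suc m + (1 + 0)
rising-size-suc = solve-∀

-- The pattern sets {0101, 0102, 0112, 0120} and {0101, 0102, 0112, 0121}

-- zeros: 0ᵃ; rising: 0ᵃ 1 ⋯ k; plateau: 0ᵃ 1 ⋯ k kᵇ; descent: 0ᵃ 1 ⋯ k kᵇ (back k)ᶜ
data Phase : Set where
  zeros rising plateau descent : Phase

phaseEdges : (ℕ → ℕ) → Phase → ℕ → List (Edge Phase)
phaseEdges back zeros   _ = edge zeros 0 0 ∷ edge rising 1 1 ∷ []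
phaseEdges back rising  k = edge rising (suc k) (suc k) ∷ edge plateau k k ∷ edge descent k (back k) ∷ []
phaseEdges back plateau k = edge plateau k k ∷ edge descent k (back k) ∷ []
phaseEdges back descent k = edge descent k (back k) ∷ []

phaseSize : Phase → ℕ → ℕ
phaseSize zeros   m = 1 + suc (suc m) C 3
phaseSize rising  m = suc (suc m) C 2
phaseSize plateau m = suc m
phaseSize descent m = 1

phaseSize-zero : ∀ c → phaseSize c 0 ≡ 1
phaseSize-zero zeros   = refl
phaseSize-zero rising  = refl
phaseSize-zero plateau = refl
phaseSize-zero descent = refl

phaseSize-suc : ∀ back c k m → phaseSize c (suc m) ≡ sum (map (λ e → phaseSize (Edge.target e) m) (phaseEdges back c k))
phaseSize-suc back zeros   k m = zeros-size-suc m
phaseSize-suc back rising  k m = trans ([1+n]C2 (suc (suc m))) (rearrange m (suc (suc m) C 2))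
  where
  rearrange : ∀ m x → suc (suc m) + x ≡ x + (suc m + (1 + 0))
  rearrange = solve-∀
phaseSize-suc back plateau k m = rising-size-suc m
phaseSize-suc back descent k m = refl

module Tree₁ where

  P₁ : List (List ℕ)
  P₁ = p0101 ∷ p0102 ∷ p0112 ∷ p0120 ∷ []

  Inv : Phase → ℕ → List ℕ → Set
  Inv zeros   _ y = Staircase ∅ 0 y × Last 0 y
  Inv rising  k y = Staircase ∅ k y × 1 ≤ k × Last k y
  Inv plateau k y = Plateau ∅ k y × Last k y
  Inv descent k y = StepDown k y × Last (k ∸ 1) y

  edges : Phase → ℕ → List (Edge Phase)
  edges = phaseEdges (_∸ 1)

  select : ∀ {y v} → Blocked y v → All (λ p → ¬ Completes p y v) P₁
  select b = ¬0101 ∷ ¬0102 ∷ ¬0112 ∷ ¬0120 ∷ []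
    where open Blocked b

  stepDown-blocked : ∀ {k y} → 1 ≤ k → All (_≤ k) y → InversionTops (_≡ k) y →
                     Repeats (λ b → b ≡ 0 ⊎ b ≡ k ⊎ b ≡ k ∸ 1) y → All (λ p → ¬ Completes p y (k ∸ 1)) P₁
  stepDown-blocked {k} 1≤k bounded t r =
    tops-block-0101 t (<⇒≢ (k∸1<k 1≤k)) ∷
    tops-block-0102 t (λ { refl → m∸n≤m k 1 }) ∷
    repeats-block-0112 r (λ where
      (inj₁ b≡0)         → inj₁ b≡0
      (inj₂ (inj₁ refl)) → inj₂ (m∸n≤m k 1)
      (inj₂ (inj₂ refl)) → inj₂ ≤-refl) ∷
    bounded-blocks-0120 bounded (m≤n+m∸n k 1) ∷ []

  inv-edge : ∀ {c k y e} → Inv c k y → e ∈ edges c k → Inv (Edge.target e) (Edge.ascents e) (y ∷ʳ Edge.letter e)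
  inv-edge {zeros}   (s , _)          (here refl)                 = staircase-∷ʳ-zero s (λ ()) (zeros-tops s) , last-∷ʳ
  inv-edge {zeros}   (s , last)       (there (here refl))         = staircase-up s last z≤n , ≤-refl , last-∷ʳ
  inv-edge {rising}  (s , _ , last)   (here refl)                 = staircase-up s last ≤-refl , s≤s z≤n , last-∷ʳ
  inv-edge {rising}  (s , 1≤k , last) (there (here refl))         = staircase-plateau s 1≤k last , last-∷ʳ
  inv-edge {rising}  (s , 1≤k , last) (there (there (here refl))) = staircase-stepDown s 1≤k last , last-∷ʳ
  inv-edge {plateau} (p , last)       (here refl)                 = plateau-extend p last , last-∷ʳ
  inv-edge {plateau} (p , last)       (there (here refl))         = plateau-stepDown p last , last-∷ʳ
  inv-edge {descent} (d , last)       (here refl)                 = stepDown-extend d last , last-∷ʳ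

  edge-admissible : ∀ {c k y e} → Inv c k y → e ∈ edges c k → Admissible P₁ y (Edge.letter e)
  edge-admissible {zeros}   (s , _)         (here refl)                 = z≤n , select (zeros-blocked s)
  edge-admissible {zeros}   (s , _)         (there (here refl))         = s≤s z≤n , select (staircase-blocked s z≤n)
  edge-admissible {rising}  (s , _ , _)     (here refl) =
    ≤1+≡⁺ (Staircase.ascents s) ≤-refl , select (staircase-blocked s (n≤1+n _))
  edge-admissible {rising}  (s , _ , _)     (there (here refl)) =
    ≤1+≡⁺ (Staircase.ascents s) (n≤1+n _) , select (staircase-blocked s ≤-refl)
  edge-admissible {rising}  (s , 1≤k , _)   (there (there (here refl))) =
    ≤1+≡⁺ ascents (≤-trans (m∸n≤m _ 1) (n≤1+n _)) , stepDown-blocked 1≤k bounded (tops-map ⊥-elim tops) (repeats-map inj₁ repeats)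
    where open Staircase s
  edge-admissible {plateau} (p , _)         (here refl) =
    ≤1+≡⁺ (Plateau.ascents p) (n≤1+n _) , select (plateau-blocked p)
  edge-admissible {plateau} (p , _)         (there (here refl)) =
    ≤1+≡⁺ ascents (≤-trans (m∸n≤m _ 1) (n≤1+n _)) , stepDown-blocked positive bounded (tops-map ⊥-elim tops) (repeats-map (Sum.map₂ inj₁) repeats)
    where open Plateau p
  edge-admissible {descent} (d , _)         (here refl) =
    ≤1+≡⁺ ascents (≤-trans (m∸n≤m _ 1) (n≤1+n _)) , stepDown-blocked positive bounded tops repeats
    where open StepDown d

  low-letter : ∀ {k y v} → Climbs k y → 1 ≤ k → ¬ Completes p0120 y v → v < k → v ≡ k ∸ 1
  low-letter {suc k} climbs 1≤k ¬0120 (s≤s v≤k) with m≤n⇒m<n∨m≡n v≤k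
  ... | inj₁ v<k = ⊥-elim (¬0120 (climbs-complete-0120 climbs v<k (n<1+n k)))
  ... | inj₂ v≡k = v≡k

  admissible-edge : ∀ {c k y v} → Inv c k y → Admissible P₁ y v → v ∈ map Edge.letter (edges c k)
  admissible-edge {zeros} (s , _) (v≤ , _) with ≤1+≡⁻ (Staircase.ascents s) v≤
  ... | z≤n     = here refl
  ... | s≤s z≤n = there (here refl)
  admissible-edge {rising} (s , 1≤k , _) (v≤ , _ ∷ _ ∷ _ ∷ ¬0120 ∷ []) with ≤1+-cases (≤1+≡⁻ (Staircase.ascents s) v≤)
  ... | inj₁ refl        = here refl
  ... | inj₂ (inj₁ refl) = there (here refl)
  ... | inj₂ (inj₂ v<k) with refl ← low-letter (Staircase.climbs s) 1≤k ¬0120 v<k = there (there (here refl))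
  admissible-edge {plateau} (p , _) (v≤ , _ ∷ _ ∷ ¬0112 ∷ ¬0120 ∷ []) with ≤1+-cases (≤1+≡⁻ (Plateau.ascents p) v≤)
  ... | inj₁ refl        = ⊥-elim (¬0112 (completes-0112⁺ (Plateau.positive p) (n<1+n _) (Plateau.0∷k∷k⊆y p)))
  ... | inj₂ (inj₁ refl) = here refl
  ... | inj₂ (inj₂ v<k) with refl ← low-letter (Plateau.climbs p) (Plateau.positive p) ¬0120 v<k = there (here refl)
  admissible-edge {descent} (d , _) (v≤ , ¬0101 ∷ ¬0102 ∷ _ ∷ ¬0120 ∷ []) with ≤1+-cases (≤1+≡⁻ (StepDown.ascents d) v≤)
  ... | inj₁ refl        = ⊥-elim (¬0102 (completes-0102⁺ (k∸1<k (StepDown.positive d)) (n<1+n _) (StepDown.k∸1∷k∷k∸1⊆y d)))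
  ... | inj₂ (inj₁ refl) = ⊥-elim (¬0101 (completes-0101⁺ (k∸1<k (StepDown.positive d)) (StepDown.k∸1∷k∷k∸1⊆y d)))
  ... | inj₂ (inj₂ v<k) with refl ← low-letter (StepDown.climbs d) (StepDown.positive d) ¬0120 v<k = here refl

  letters-unique : ∀ {c k y} → Inv c k y → Unique (map Edge.letter (edges c k))
  letters-unique {zeros}   _             = ((λ ()) ∷ []) ∷ [] ∷ []
  letters-unique {rising}  (_ , 1≤k , _) = (>⇒≢ (n<1+n _) ∷ >⇒≢ (s≤s (m∸n≤m _ 1)) ∷ []) ∷ (>⇒≢ (k∸1<k 1≤k) ∷ []) ∷ [] ∷ []
  letters-unique {plateau} (p , _)       = (>⇒≢ (k∸1<k (Plateau.positive p)) ∷ []) ∷ [] ∷ []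
  letters-unique {descent} _             = [] ∷ []

  tree : GeneratingTree P₁
  tree = record
    { Class           = Phase
    ; root            = zeros
    ; edges           = edges
    ; Inv             = Inv
    ; patterns-long   = s<s z<s ∷ s<s z<s ∷ s<s z<s ∷ s<s z<s ∷ []
    ; inv-root        = root-staircase , ([] , refl)
    ; inv-edge        = inv-edge
    ; edge-admissible = edge-admissible
    ; admissible-edge = admissible-edge
    ; letters-unique  = letters-unique
    ; size            = phaseSize
    ; size-zero       = phaseSize-zero
    ; size-suc        = phaseSize-suc (_∸ 1)
    }

module Tree₂ where

  P₂ : List (List ℕ)
  P₂ = p0101 ∷ p0102 ∷ p0112 ∷ p0121 ∷ []

  Inv : Phase → ℕ → List ℕ → Set
  Inv zeros   _ y = Staircase ∅ 0 y × Last 0 y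
  Inv rising  k y = Staircase ∅ k y × 1 ≤ k × Last k y
  Inv plateau k y = Plateau ∅ k y × Last k y
  Inv descent k y = Valley k y

  edges : Phase → ℕ → List (Edge Phase)
  edges = phaseEdges (λ _ → 0)

  select : ∀ {y v} → Blocked y v → All (λ p → ¬ Completes p y v) P₂
  select b = ¬0101 ∷ ¬0102 ∷ ¬0112 ∷ ¬0121 ∷ []
    where open Blocked b

  zero-blocked₂ : ∀ {y} → All (λ p → ¬ Completes p y 0) P₂
  zero-blocked₂ = zero-blocks-0101 ∷ zero-blocks-0102 ∷ zero-blocks-0112 ∷ zero-blocks-0121 ∷ []

  inv-edge : ∀ {c k y e} → Inv c k y → e ∈ edges c k → Inv (Edge.target e) (Edge.ascents e) (y ∷ʳ Edge.letter e)
  inv-edge {zeros}   (s , _)          (here refl)                 = staircase-∷ʳ-zero s (λ ()) (zeros-tops s) , last-∷ʳ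
  inv-edge {zeros}   (s , last)       (there (here refl))         = staircase-up s last z≤n , ≤-refl , last-∷ʳ
  inv-edge {rising}  (s , _ , last)   (here refl)                 = staircase-up s last ≤-refl , s≤s z≤n , last-∷ʳ
  inv-edge {rising}  (s , 1≤k , last) (there (here refl))         = staircase-plateau s 1≤k last , last-∷ʳ
  inv-edge {rising}  (s , 1≤k , _)    (there (there (here refl))) = staircase-valley s 1≤k
  inv-edge {plateau} (p , last)       (here refl)                 = plateau-extend p last , last-∷ʳ
  inv-edge {plateau} (p , _)          (there (here refl))         = plateau-valley p
  inv-edge {descent} v                (here refl)                 = valley-extend v

  edge-admissible : ∀ {c k y e} → Inv c k y → e ∈ edges c k → Admissible P₂ y (Edge.letter e)
  edge-admissible {zeros}   _           (here refl)                 = z≤n , zero-blocked₂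
  edge-admissible {zeros}   (s , _)     (there (here refl))         = s≤s z≤n , select (staircase-blocked s z≤n)
  edge-admissible {rising}  (s , _ , _) (here refl) =
    ≤1+≡⁺ (Staircase.ascents s) ≤-refl , select (staircase-blocked s (n≤1+n _))
  edge-admissible {rising}  (s , _ , _) (there (here refl)) =
    ≤1+≡⁺ (Staircase.ascents s) (n≤1+n _) , select (staircase-blocked s ≤-refl)
  edge-admissible {rising}  _           (there (there (here refl))) = z≤n , zero-blocked₂
  edge-admissible {plateau} (p , _)     (here refl) =
    ≤1+≡⁺ (Plateau.ascents p) (n≤1+n _) , select (plateau-blocked p)
  edge-admissible {plateau} _           (there (here refl))         = z≤n , zero-blocked₂
  edge-admissible {descent} _           (here refl)                 = z≤n , zero-blocked₂

  low-letter : ∀ {k y v} → Climbs k y → ¬ Completes p0121 y v → v < k → v ≡ 0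
  low-letter {v = zero}  climbs ¬0121 _   = refl
  low-letter {v = suc _} climbs ¬0121 v<k = ⊥-elim (¬0121 (climbs-complete-0121 climbs z<s v<k))

  admissible-edge : ∀ {c k y v} → Inv c k y → Admissible P₂ y v → v ∈ map Edge.letter (edges c k)
  admissible-edge {zeros} (s , _) (v≤ , _) with ≤1+≡⁻ (Staircase.ascents s) v≤
  ... | z≤n     = here refl
  ... | s≤s z≤n = there (here refl)
  admissible-edge {rising} (s , _ , _) (v≤ , _ ∷ _ ∷ _ ∷ ¬0121 ∷ []) with ≤1+-cases (≤1+≡⁻ (Staircase.ascents s) v≤)
  ... | inj₁ refl        = here refl
  ... | inj₂ (inj₁ refl) = there (here refl)
  ... | inj₂ (inj₂ v<k) with refl ← low-letter (Staircase.climbs s) ¬0121 v<k = there (there (here refl))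
  admissible-edge {plateau} (p , _) (v≤ , _ ∷ _ ∷ ¬0112 ∷ ¬0121 ∷ []) with ≤1+-cases (≤1+≡⁻ (Plateau.ascents p) v≤)
  ... | inj₁ refl        = ⊥-elim (¬0112 (completes-0112⁺ (Plateau.positive p) (n<1+n _) (Plateau.0∷k∷k⊆y p)))
  ... | inj₂ (inj₁ refl) = here refl
  ... | inj₂ (inj₂ v<k) with refl ← low-letter (Plateau.climbs p) ¬0121 v<k = there (here refl)
  admissible-edge {descent} d (v≤ , ¬0101 ∷ ¬0102 ∷ _ ∷ ¬0121 ∷ []) with ≤1+-cases (≤1+≡⁻ (Valley.ascents d) v≤)
  ... | inj₁ refl        = ⊥-elim (¬0102 (completes-0102⁺ (Valley.positive d) (n<1+n _) (Valley.0∷k∷0⊆y d)))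
  ... | inj₂ (inj₁ refl) = ⊥-elim (¬0101 (completes-0101⁺ (Valley.positive d) (Valley.0∷k∷0⊆y d)))
  ... | inj₂ (inj₂ v<k) with refl ← low-letter (Valley.climbs d) ¬0121 v<k = here refl

  letters-unique : ∀ {c k y} → Inv c k y → Unique (map Edge.letter (edges c k))
  letters-unique {zeros}   _             = ((λ ()) ∷ []) ∷ [] ∷ []
  letters-unique {rising}  (_ , 1≤k , _) = (>⇒≢ (n<1+n _) ∷ (λ ()) ∷ []) ∷ (>⇒≢ 1≤k ∷ []) ∷ [] ∷ []
  letters-unique {plateau} (p , _)       = (>⇒≢ (Plateau.positive p) ∷ []) ∷ [] ∷ []
  letters-unique {descent} _             = [] ∷ []

  tree : GeneratingTree P₂
  tree = record
    { Class           = Phase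
    ; root            = zeros
    ; edges           = edges
    ; Inv             = Inv
    ; patterns-long   = s<s z<s ∷ s<s z<s ∷ s<s z<s ∷ s<s z<s ∷ []
    ; inv-root        = root-staircase , ([] , refl)
    ; inv-edge        = inv-edge
    ; edge-admissible = edge-admissible
    ; admissible-edge = admissible-edge
    ; letters-unique  = letters-unique
    ; size            = phaseSize
    ; size-zero       = phaseSize-zero
    ; size-suc        = phaseSize-suc (λ _ → 0)
    }

-- The pattern set {0101, 0112, 0120, 0121}

-- zeros: 0ᵃ; one: 0ᵃ 1; rising: 0ᵃ 1 ⋯ k; ones: 0ᵃ 1 1ᵇ; plateau: 0ᵃ 1 ⋯ k kᵇ; dip: 0ᵃ 1 0ᶜ;
-- onesDip: 0ᵃ 1 1ᵇ 0ᶜ; dipRising: 0ᵃ 1 0ᶜ 2 ⋯ k; dipPlateau: 0ᵃ 1 0ᶜ 2 ⋯ k kᵇ (with k ≥ 2 where it occurs)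
data Stage : Set where
  zeros one rising ones plateau dip onesDip dipRising dipPlateau : Stage

module Tree₃ where

  P₃ : List (List ℕ)
  P₃ = p0101 ∷ p0112 ∷ p0120 ∷ p0121 ∷ []

  Inv : Stage → ℕ → List ℕ → Set
  Inv zeros      _ y = Staircase ∅ 0 y × Last 0 y
  Inv one        _ y = Staircase ∅ 1 y × Last 1 y
  Inv rising     k y = Staircase ∅ k y × 2 ≤ k × Last k y
  Inv ones       _ y = Plateau ∅ 1 y × Last 1 y
  Inv plateau    k y = Plateau ∅ k y × 2 ≤ k × Last k y
  Inv dip        _ y = Staircase (_≡ 1) 1 y × 0 ∷ 1 ∷ 0 ∷ [] ⊆ y × Last 0 y
  Inv onesDip    _ y = Valley 1 y × 0 ∷ 1 ∷ 1 ∷ [] ⊆ y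
  Inv dipRising  k y = Staircase (_≡ 1) k y × 2 ≤ k × Last k y
  Inv dipPlateau k y = Plateau (_≡ 1) k y × 2 ≤ k × Last k y

  edges : Stage → ℕ → List (Edge Stage)
  edges zeros      _ = edge zeros 0 0 ∷ edge one 1 1 ∷ []
  edges one        _ = edge dip 1 0 ∷ edge ones 1 1 ∷ edge rising 2 2 ∷ []
  edges rising     k = edge rising (suc k) (suc k) ∷ edge plateau k k ∷ []
  edges ones       _ = edge onesDip 1 0 ∷ edge ones 1 1 ∷ []
  edges plateau    k = edge plateau k k ∷ []
  edges dip        _ = edge dip 1 0 ∷ edge dipRising 2 2 ∷ []
  edges onesDip    _ = edge onesDip 1 0 ∷ []
  edges dipRising  k = edge dipRising (suc k) (suc k) ∷ edge dipPlateau k k ∷ []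
  edges dipPlateau k = edge dipPlateau k k ∷ []

  size : Stage → ℕ → ℕ
  size zeros      m = 1 + suc (suc m) C 3
  size one        m = suc (suc m) C 2
  size rising     m = suc m
  size ones       m = suc m
  size plateau    _ = 1
  size dip        m = 1 + suc m C 2
  size onesDip    _ = 1
  size dipRising  m = suc m
  size dipPlateau _ = 1

  size-zero : ∀ c → size c 0 ≡ 1
  size-zero zeros      = refl
  size-zero one        = refl
  size-zero rising     = refl
  size-zero ones       = refl
  size-zero plateau    = refl
  size-zero dip        = refl
  size-zero onesDip    = refl
  size-zero dipRising  = refl
  size-zero dipPlateau = refl

  size-suc : ∀ c k m → size c (suc m) ≡ sum (map (λ e → size (Edge.target e) m) (edges c k))
  size-suc zeros      _ m = zeros-size-suc m
  size-suc one        _ m = trans ([1+n]C2 (suc (suc m))) (trans (cong (suc (suc m) +_) ([1+n]C2 (suc m))) (rearrange m (suc m C 2)))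
    where
    rearrange : ∀ m x → suc (suc m) + (suc m + x) ≡ (1 + x) + (suc m + (suc m + 0))
    rearrange = solve-∀
  size-suc rising     _ m = rising-size-suc m
  size-suc ones       _ m = rearrange m
    where
    rearrange : ∀ m → suc (suc m) ≡ 1 + (suc m + 0)
    rearrange = solve-∀
  size-suc plateau    _ m = refl
  size-suc dip        _ m = trans (cong (1 +_) ([1+n]C2 (suc m))) (rearrange m (suc m C 2))
    where
    rearrange : ∀ m x → 1 + (suc m + x) ≡ (1 + x) + (suc m + 0)
    rearrange = solve-∀
  size-suc onesDip    _ m = refl
  size-suc dipRising  _ m = rising-size-suc m
  size-suc dipPlateau _ m = refl

  select : ∀ {y v} → Blocked y v → All (λ p → ¬ Completes p y v) P₃
  select b = ¬0101 ∷ ¬0112 ∷ ¬0120 ∷ ¬0121 ∷ []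
    where open Blocked b

  dip-blocked : ∀ {k y v} → 2 ≤ v → k ≤ v → All (_≤ k) y → InversionTops (_≡ 1) y →
                Repeats (λ b → b ≡ 0 ⊎ v ≤ b) y → All (λ p → ¬ Completes p y v) P₃
  dip-blocked 2≤v k≤v bounded t r =
    tops-block-0101 t (>⇒≢ 2≤v) ∷
    repeats-block-0112 r (λ b≡0⊎v≤b → b≡0⊎v≤b) ∷
    bounded-blocks-0120 bounded (m≤n⇒m≤1+n k≤v) ∷
    bounded-blocks-0121 bounded k≤v ∷ []

  one-tops : ∀ {R y} → Staircase R 1 y → ∀ {u} → u ∈ y → 0 < u → u ≡ 1
  one-tops s u∈y 0<u = ≤-antisym (All.lookup (Staircase.bounded s) u∈y) 0<u

  inv-edge : ∀ {c k y e} → Inv c k y → e ∈ edges c k → Inv (Edge.target e) (Edge.ascents e) (y ∷ʳ Edge.letter e)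
  inv-edge {zeros}      (s , _)          (here refl)                 = staircase-∷ʳ-zero s (λ ()) (zeros-tops s) , last-∷ʳ
  inv-edge {zeros}      (s , last)       (there (here refl))         = staircase-up s last z≤n , last-∷ʳ
  inv-edge {one}        (s , _)          (here refl) =
    staircase-∷ʳ-zero s (λ ()) (one-tops s) , keep-∷ʳ (Staircase.pairs s z<s ≤-refl) , last-∷ʳ
  inv-edge {one}        (s , last)       (there (here refl))         = staircase-plateau s ≤-refl last , last-∷ʳ
  inv-edge {one}        (s , last)       (there (there (here refl))) = staircase-up s last ≤-refl , ≤-refl , last-∷ʳ
  inv-edge {rising}     (s , 2≤k , last) (here refl)                 = staircase-up s last ≤-refl , m≤n⇒m≤1+n 2≤k , last-∷ʳ
  inv-edge {rising}     (s , 2≤k , last) (there (here refl))         = staircase-plateau s (<⇒≤ 2≤k) last , 2≤k , last-∷ʳ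
  inv-edge {ones}       (p , _)          (here refl)                 = plateau-valley p , skip-∷ʳ (Plateau.0∷k∷k⊆y p)
  inv-edge {ones}       (p , last)       (there (here refl))         = plateau-extend p last , last-∷ʳ
  inv-edge {plateau}    (p , 2≤k , last) (here refl)                 = plateau-extend p last , 2≤k , last-∷ʳ
  inv-edge {dip}        (s , 010⊆y , _)  (here refl) =
    staircase-∷ʳ-zero s (λ u≡1 → u≡1) (one-tops s) , skip-∷ʳ 010⊆y , last-∷ʳ
  inv-edge {dip}        (s , _ , last)   (there (here refl))         = staircase-up s last z≤n , ≤-refl , last-∷ʳ
  inv-edge {onesDip}    (v , 011⊆y)      (here refl)                 = valley-extend v , skip-∷ʳ 011⊆y
  inv-edge {dipRising}  (s , 2≤k , last) (here refl)                 = staircase-up s last ≤-refl , m≤n⇒m≤1+n 2≤k , last-∷ʳ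
  inv-edge {dipRising}  (s , 2≤k , last) (there (here refl))         = staircase-plateau s (<⇒≤ 2≤k) last , 2≤k , last-∷ʳ
  inv-edge {dipPlateau} (p , 2≤k , last) (here refl)                 = plateau-extend p last , 2≤k , last-∷ʳ

  edge-admissible : ∀ {c k y e} → Inv c k y → e ∈ edges c k → Admissible P₃ y (Edge.letter e)
  edge-admissible {zeros}      (s , _)     (here refl)                 = z≤n , select (zeros-blocked s)
  edge-admissible {zeros}      (s , _)     (there (here refl))         = s≤s z≤n , select (staircase-blocked s z≤n)
  edge-admissible {one}        (s , _)     (here refl)                 = z≤n , select (zero-blocked (Staircase.bounded s))
  edge-admissible {one}        (s , _)     (there (here refl)) =
    ≤1+≡⁺ (Staircase.ascents s) (n≤1+n 1) , select (staircase-blocked s ≤-refl)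
  edge-admissible {one}        (s , _)     (there (there (here refl))) =
    ≤1+≡⁺ (Staircase.ascents s) ≤-refl , select (staircase-blocked s (n≤1+n 1))
  edge-admissible {rising}     (s , _)     (here refl) =
    ≤1+≡⁺ (Staircase.ascents s) ≤-refl , select (staircase-blocked s (n≤1+n _))
  edge-admissible {rising}     (s , _)     (there (here refl)) =
    ≤1+≡⁺ (Staircase.ascents s) (n≤1+n _) , select (staircase-blocked s ≤-refl)
  edge-admissible {ones}       (p , _)     (here refl)                 = z≤n , select (zero-blocked (Plateau.bounded p))
  edge-admissible {ones}       (p , _)     (there (here refl)) =
    ≤1+≡⁺ (Plateau.ascents p) (n≤1+n _) , select (plateau-blocked p)
  edge-admissible {plateau}    (p , _)     (here refl) =
    ≤1+≡⁺ (Plateau.ascents p) (n≤1+n _) , select (plateau-blocked p)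
  edge-admissible {dip}        (s , _)     (here refl)                 = z≤n , select (zero-blocked (Staircase.bounded s))
  edge-admissible {dip}        (s , _)     (there (here refl)) =
    ≤1+≡⁺ ascents ≤-refl , dip-blocked ≤-refl (n≤1+n 1) bounded tops (repeats-map inj₁ repeats)
    where open Staircase s
  edge-admissible {onesDip}    (v , _)     (here refl)                 = z≤n , select (zero-blocked (Valley.bounded v))
  edge-admissible {dipRising}  (s , 2≤k , _) (here refl) =
    ≤1+≡⁺ ascents ≤-refl , dip-blocked (m≤n⇒m≤1+n 2≤k) (n≤1+n _) bounded tops (repeats-map inj₁ repeats)
    where open Staircase s
  edge-admissible {dipRising}  (s , 2≤k , _) (there (here refl)) =
    ≤1+≡⁺ ascents (n≤1+n _) , dip-blocked 2≤k ≤-refl bounded tops (repeats-map inj₁ repeats)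
    where open Staircase s
  edge-admissible {dipPlateau} (p , 2≤k , _) (here refl) =
    ≤1+≡⁺ ascents (n≤1+n _) , dip-blocked 2≤k ≤-refl bounded tops (repeats-map (Sum.map₂ (≤-reflexive ∘ sym)) repeats)
    where open Plateau p

  low-letter : ∀ {k y v} → Climbs k y → 2 ≤ k → ¬ Completes p0120 y v → ¬ Completes p0121 y v → ¬ v < k
  low-letter {v = zero}  climbs 2≤k ¬0120 _     _   = ¬0120 (climbs-complete-0120 climbs z<s 2≤k)
  low-letter {v = suc _} climbs _   _     ¬0121 v<k = ¬0121 (climbs-complete-0121 climbs z<s v<k)

  admissible-edge : ∀ {c k y v} → Inv c k y → Admissible P₃ y v → v ∈ map Edge.letter (edges c k)
  admissible-edge {zeros} (s , _) (v≤ , _) with ≤1+≡⁻ (Staircase.ascents s) v≤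
  ... | z≤n     = here refl
  ... | s≤s z≤n = there (here refl)
  admissible-edge {one} (s , _) (v≤ , _) with ≤2-cases (≤1+≡⁻ (Staircase.ascents s) v≤)
  ... | inj₁ refl        = here refl
  ... | inj₂ (inj₁ refl) = there (here refl)
  ... | inj₂ (inj₂ refl) = there (there (here refl))
  admissible-edge {rising} (s , 2≤k , _) (v≤ , _ ∷ _ ∷ ¬0120 ∷ ¬0121 ∷ []) with ≤1+-cases (≤1+≡⁻ (Staircase.ascents s) v≤)
  ... | inj₁ refl        = here refl
  ... | inj₂ (inj₁ refl) = there (here refl)
  ... | inj₂ (inj₂ v<k)  = ⊥-elim (low-letter (Staircase.climbs s) 2≤k ¬0120 ¬0121 v<k)
  admissible-edge {ones} (p , _) (v≤ , _ ∷ ¬0112 ∷ _) with ≤2-cases (≤1+≡⁻ (Plateau.ascents p) v≤)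
  ... | inj₁ refl        = here refl
  ... | inj₂ (inj₁ refl) = there (here refl)
  ... | inj₂ (inj₂ refl) = ⊥-elim (¬0112 (completes-0112⁺ z<s (n<1+n 1) (Plateau.0∷k∷k⊆y p)))
  admissible-edge {plateau} (p , 2≤k , _) (v≤ , _ ∷ ¬0112 ∷ ¬0120 ∷ ¬0121 ∷ []) with ≤1+-cases (≤1+≡⁻ (Plateau.ascents p) v≤)
  ... | inj₁ refl        = ⊥-elim (¬0112 (completes-0112⁺ (Plateau.positive p) (n<1+n _) (Plateau.0∷k∷k⊆y p)))
  ... | inj₂ (inj₁ refl) = here refl
  ... | inj₂ (inj₂ v<k)  = ⊥-elim (low-letter (Plateau.climbs p) 2≤k ¬0120 ¬0121 v<k)
  admissible-edge {dip} (s , 010⊆y , _) (v≤ , ¬0101 ∷ _) with ≤2-cases (≤1+≡⁻ (Staircase.ascents s) v≤)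
  ... | inj₁ refl        = here refl
  ... | inj₂ (inj₁ refl) = ⊥-elim (¬0101 (completes-0101⁺ z<s 010⊆y))
  ... | inj₂ (inj₂ refl) = there (here refl)
  admissible-edge {onesDip} (v , 011⊆y) (v≤ , ¬0101 ∷ ¬0112 ∷ _) with ≤2-cases (≤1+≡⁻ (Valley.ascents v) v≤)
  ... | inj₁ refl        = here refl
  ... | inj₂ (inj₁ refl) = ⊥-elim (¬0101 (completes-0101⁺ z<s (Valley.0∷k∷0⊆y v)))
  ... | inj₂ (inj₂ refl) = ⊥-elim (¬0112 (completes-0112⁺ z<s (n<1+n 1) 011⊆y))
  admissible-edge {dipRising} (s , 2≤k , _) (v≤ , _ ∷ _ ∷ ¬0120 ∷ ¬0121 ∷ []) with ≤1+-cases (≤1+≡⁻ (Staircase.ascents s) v≤)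
  ... | inj₁ refl        = here refl
  ... | inj₂ (inj₁ refl) = there (here refl)
  ... | inj₂ (inj₂ v<k)  = ⊥-elim (low-letter (Staircase.climbs s) 2≤k ¬0120 ¬0121 v<k)
  admissible-edge {dipPlateau} (p , 2≤k , _) (v≤ , _ ∷ ¬0112 ∷ ¬0120 ∷ ¬0121 ∷ []) with ≤1+-cases (≤1+≡⁻ (Plateau.ascents p) v≤)
  ... | inj₁ refl        = ⊥-elim (¬0112 (completes-0112⁺ (Plateau.positive p) (n<1+n _) (Plateau.0∷k∷k⊆y p)))
  ... | inj₂ (inj₁ refl) = here refl
  ... | inj₂ (inj₂ v<k)  = ⊥-elim (low-letter (Plateau.climbs p) 2≤k ¬0120 ¬0121 v<k)

  letters-unique : ∀ {c k y} → Inv c k y → Unique (map Edge.letter (edges c k))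
  letters-unique {zeros}      _ = ((λ ()) ∷ []) ∷ [] ∷ []
  letters-unique {one}        _ = ((λ ()) ∷ (λ ()) ∷ []) ∷ ((λ ()) ∷ []) ∷ [] ∷ []
  letters-unique {rising}     _ = (>⇒≢ (n<1+n _) ∷ []) ∷ [] ∷ []
  letters-unique {ones}       _ = ((λ ()) ∷ []) ∷ [] ∷ []
  letters-unique {plateau}    _ = [] ∷ []
  letters-unique {dip}        _ = ((λ ()) ∷ []) ∷ [] ∷ []
  letters-unique {onesDip}    _ = [] ∷ []
  letters-unique {dipRising}  _ = (>⇒≢ (n<1+n _) ∷ []) ∷ [] ∷ []
  letters-unique {dipPlateau} _ = [] ∷ []

  tree : GeneratingTree P₃
  tree = record
    { Class           = Stage
    ; root            = zeros
    ; edges           = edges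
    ; Inv             = Inv
    ; patterns-long   = s<s z<s ∷ s<s z<s ∷ s<s z<s ∷ s<s z<s ∷ []
    ; inv-root        = root-staircase , ([] , refl)
    ; inv-edge        = inv-edge
    ; edge-admissible = edge-admissible
    ; admissible-edge = admissible-edge
    ; letters-unique  = letters-unique
    ; size            = size
    ; size-zero       = size-zero
    ; size-suc        = size-suc
    }

theorem5p1 : ∀ (n : ℕ) → 1 ≤ n →
    HasCount (p0101 ∷ p0102 ∷ p0112 ∷ p0120 ∷ []) n (1 + (suc n C 3))
    × HasCount (p0101 ∷ p0102 ∷ p0112 ∷ p0121 ∷ []) n (1 + (suc n C 3))
    × HasCount (p0101 ∷ p0112 ∷ p0120 ∷ p0121 ∷ []) n (1 + (suc n C 3))
theorem5p1 (suc m) _ = enumerate Tree₁.tree m , enumerate Tree₂.tree m , enumerate Tree₃.tree m
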